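{- Let $\mathbf R=(I,O,R)$ and $\mathbf S=(I',O',S)$ be routing areas, $o\in O$ and $i\in I'$. Then the net obtained by connecting the output $o$ of $\mathbf R$ to the input $i$ of $\mathbf S$ reduces to a routing area $\mathbf T=(I+I'\setminus\{i\},\,O+O'\setminus\{o\},\,T)$ for some multirelation $T$.
   Context: A multirelation between finite sets $A$ and $B$ is a map $R:A\times B\to\mathbb N$; $+$ denotes disjoint union. Nets are differential proof nets built from contraction (binary $?$), weakening (0-ary $?$), cocontraction (binary $!$) and coweakening (0-ary $!$) cells, considered modulo associativity and commutativity of contraction and cocontraction and neutrality of weakening for contraction and of coweakening for cocontraction. Reduction rules: (ba) contraction facing cocontraction (principal ports connected) is replaced by two contractions and two cocontractions connected crosswise; (s1) coweakening facing contraction becomes two coweakenings; (s2) cocontraction facing weakening becomes two weakenings; ($\epsilon$) coweakening facing weakening is erased. Routing area: given finite sets $I$ (input labels), $O$ (output labels) and a multirelation $R$ between them, $\mathbf R=(I,O,R)$ is the net with free wires labelled by $I$ (inputs) and $O$ (outputs), each input connected to the principal port of a contraction tree, each output to the principal port of a cocontraction tree, and the tree of $i$ connected to the tree of $o$ by exactly $R(i,o)$ wires (trees with 0 leaves being (co)weakenings and with 1 leaf plain wires). -}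

module Defs where

open import Data.Nat using (ℕ; suc)
open import Data.Fin using (Fin; zero; suc; _≟_)
open import Data.Sum using (_⊎_; inj₁; inj₂; [_,_])
open import Data.Product using (Σ; _×_; _,_)
open import Data.Empty using (⊥; ⊥-elim)
open import Data.Unit using (⊤; tt)
open import Data.Bool using (Bool; true; false)
open import Function using (id)
open import Function.Bundles using (_↔_; Inverse)
open import Relation.Nullary using (yes; no)
open import Relation.Nullary.Decidable using (False; fromWitnessFalse)
open import Relation.Binary.PropositionalEquality using (_≡_)
open import Relation.Binary.Construct.Closure.ReflexiveTransitive using (Star)
open import Relation.Binary.Construct.Closure.Equivalence using (EqClosure)

Multirel : Set → Set → Set
Multirel A B = A × B → ℕ

-- A cell has a polarity: qm = "?" (contraction / weakening family),
-- bang = "!" (cocontraction / coweakening family), and a type of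
-- auxiliary ports.  A binary contraction is a qm-cell with aux ports
-- Fin 2, a weakening a qm-cell with aux ports Fin 0 (dually for !).
-- General aux types are the standard rendering of trees of (co)contractions
-- modulo associativity / commutativity / neutrality (see _≈_ below).

data Pol : Set where
  qm bang : Pol

dual : Pol → Pol
dual qm = bang
dual bang = qm

data Port (L C : Set) (A : C → Set) : Set where
  free : L → Port L C A
  prin : C → Port L C A
  aux  : (c : C) → A c → Port L C A

-- a net: cells, their polarity, aux ports, and the wiring (each port is
-- sent to the port at the other end of its wire)
record Net (L : Set) : Set₁ where
  field
    Cell : Set
    pol  : Cell → Pol
    Aux  : Cell → Set
    link : Port L Cell Aux → Port L Cell Aux

open Net

mapPort : {L L' C : Set} {A : C → Set} → (L → L') → Port L C A → Port L' C A
mapPort f (free l) = free (f l)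
mapPort f (prin c) = prin c
mapPort f (aux c a) = aux c a

-- renaming of free labels along a bijection given by f with inverse g
rename : {L L' : Set} → (L → L') → (L' → L) → Net L → Net L'
rename f g N = record
  { Cell = Cell N ; pol = pol N ; Aux = Aux N
  ; link = λ p → mapPort f (link N (mapPort g p)) }

-- Gluing two nets along a common set X of free labels
-- (free port x of N₁ is connected to free port x of N₂).

module Glue {L₁ L₂ X : Set} (N₁ : Net (L₁ ⊎ X)) (N₂ : Net (L₂ ⊎ X)) where
  C : Set
  C = Cell N₁ ⊎ Cell N₂

  Ax : C → Set
  Ax (inj₁ c) = Aux N₁ c
  Ax (inj₂ c) = Aux N₂ c

  Pt : Set
  Pt = Port (L₁ ⊎ L₂) C Ax

  emb₁ : Port (L₁ ⊎ X) (Cell N₁) (Aux N₁) → Pt ⊎ X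
  emb₁ (free (inj₁ l)) = inj₁ (free (inj₁ l))
  emb₁ (free (inj₂ x)) = inj₂ x
  emb₁ (prin c) = inj₁ (prin (inj₁ c))
  emb₁ (aux c a) = inj₁ (aux (inj₁ c) a)

  emb₂ : Port (L₂ ⊎ X) (Cell N₂) (Aux N₂) → Pt ⊎ X
  emb₂ (free (inj₁ l)) = inj₁ (free (inj₂ l))
  emb₂ (free (inj₂ x)) = inj₂ x
  emb₂ (prin c) = inj₁ (prin (inj₂ c))
  emb₂ (aux c a) = inj₁ (aux (inj₂ c) a)

  hop₁ hop₂ : X → Pt ⊎ X
  hop₁ x = emb₁ (link N₁ (free (inj₂ x)))
  hop₂ x = emb₂ (link N₂ (free (inj₂ x)))

  -- follow a wire across the interface (at most three wire segments;
  -- enough as soon as one side has no wire between two X-ports)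
  last : Pt → Pt ⊎ X → Pt
  last p (inj₁ q) = q
  last p (inj₂ _) = p

  resolve : Pt → (X → Pt ⊎ X) → (X → Pt ⊎ X) → Pt ⊎ X → Pt
  resolve p h h' (inj₁ q) = q
  resolve p h h' (inj₂ x) with h x
  ... | inj₁ q = q
  ... | inj₂ x' = last p (h' x')

  lnk : Pt → Pt
  lnk p@(free (inj₁ l)) = resolve p hop₂ hop₁ (emb₁ (link N₁ (free (inj₁ l))))
  lnk p@(free (inj₂ l)) = resolve p hop₁ hop₂ (emb₂ (link N₂ (free (inj₁ l))))
  lnk p@(prin (inj₁ c)) = resolve p hop₂ hop₁ (emb₁ (link N₁ (prin c)))
  lnk p@(prin (inj₂ c)) = resolve p hop₁ hop₂ (emb₂ (link N₂ (prin c)))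
  lnk p@(aux (inj₁ c) a) = resolve p hop₂ hop₁ (emb₁ (link N₁ (aux c a)))
  lnk p@(aux (inj₂ c) a) = resolve p hop₁ hop₂ (emb₂ (link N₂ (aux c a)))

  glue : Net (L₁ ⊎ L₂)
  glue = record { Cell = C ; pol = [ pol N₁ , pol N₂ ] ; Aux = Ax ; link = lnk }

open Glue public using (glue)

-- Isomorphism of nets (identity on free labels).  The bijections on aux
-- ports make (co)contraction commutative.

module _ {L : Set} (N M : Net L) where
  portMap : (f : Cell N ↔ Cell M) → (∀ c → Aux N c ↔ Aux M (Inverse.to f c))
          → Port L (Cell N) (Aux N) → Port L (Cell M) (Aux M)
  portMap f g (free l) = free l
  portMap f g (prin c) = prin (Inverse.to f c)
  portMap f g (aux c a) = aux (Inverse.to f c) (Inverse.to (g c) a)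

  record _≅_ : Set where
    field
      cellIso : Cell N ↔ Cell M
      auxIso  : ∀ c → Aux N c ↔ Aux M (Inverse.to cellIso c)
      polEq   : ∀ c → pol M (Inverse.to cellIso c) ≡ pol N c
      linkEq  : ∀ p → link M (portMap cellIso auxIso p)
                      ≡ portMap cellIso auxIso (link N p)

-- Local rewriting: N contains the redex P (with interface X) in a
-- context K, and M is obtained by replacing P with P'.

close : {L : Set} → Net (L ⊎ ⊥) → Net L
close = rename [ id , ⊥-elim ] inj₁

lift : {X : Set} → Net X → Net (⊥ ⊎ X)
lift = rename inj₂ [ ⊥-elim , id ]

NoXX : {L X : Set} → Net (L ⊎ X) → Set
NoXX {L} {X} K = ∀ (x y : X) → link K (free (inj₂ x)) ≡ free (inj₂ y) → ⊥

Rewrite : {L X : Set} → Net X → Net X → Net L → Net L → Set₁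
Rewrite {L} {X} P P' N M =
  Σ (Net (L ⊎ X)) λ K → NoXX K
    × (N ≅ close (glue K (lift P)))
    × (M ≅ close (glue K (lift P')))

-- flattening: a p-cell whose aux port inj₂ tt faces the principal port
-- of another p-cell  ≡  a single p-cell with the union of aux ports.
-- Interface: inj₁ tt = principal of the top cell, inj₂ s = leaves.
data FlCell : Set where
  top sub : FlCell

module _ (p : Pol) (A B : Set) where
  flAux : FlCell → Set
  flAux top = A ⊎ ⊤
  flAux sub = B

  flLink : Port (⊤ ⊎ (A ⊎ B)) FlCell flAux → Port (⊤ ⊎ (A ⊎ B)) FlCell flAux
  flLink (free (inj₁ tt)) = prin top
  flLink (free (inj₂ (inj₁ a))) = aux top (inj₁ a)
  flLink (free (inj₂ (inj₂ b))) = aux sub b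
  flLink (prin top) = free (inj₁ tt)
  flLink (prin sub) = aux top (inj₂ tt)
  flLink (aux top (inj₁ a)) = free (inj₂ (inj₁ a))
  flLink (aux top (inj₂ tt)) = prin sub
  flLink (aux sub b) = free (inj₂ (inj₂ b))

  flatL : Net (⊤ ⊎ (A ⊎ B))
  flatL = record { Cell = FlCell ; pol = λ _ → p ; Aux = flAux ; link = flLink }

  flLink' : Port (⊤ ⊎ (A ⊎ B)) ⊤ (λ _ → A ⊎ B) → Port (⊤ ⊎ (A ⊎ B)) ⊤ (λ _ → A ⊎ B)
  flLink' (free (inj₁ tt)) = prin tt
  flLink' (free (inj₂ s)) = aux tt s
  flLink' (prin tt) = free (inj₁ tt)
  flLink' (aux tt s) = free (inj₂ s)

  flatR : Net (⊤ ⊎ (A ⊎ B))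
  flatR = record { Cell = ⊤ ; pol = λ _ → p ; Aux = λ _ → A ⊎ B ; link = flLink' }

-- unary cell ≡ plain wire (interface: false = principal, true = aux)
module _ (p : Pol) where
  unLink : Port Bool ⊤ (λ _ → ⊤) → Port Bool ⊤ (λ _ → ⊤)
  unLink (free false) = prin tt
  unLink (free true) = aux tt tt
  unLink (prin tt) = free false
  unLink (aux tt tt) = free true

  unitL : Net Bool
  unitL = record { Cell = ⊤ ; pol = λ _ → p ; Aux = λ _ → ⊤ ; link = unLink }

wireLink : Port Bool ⊥ (λ _ → ⊥) → Port Bool ⊥ (λ _ → ⊥)
wireLink (free false) = free true
wireLink (free true) = free false
wireLink (prin ())
wireLink (aux () _)

unitR : Net Bool
unitR = record { Cell = ⊥ ; pol = λ () ; Aux = λ _ → ⊥ ; link = wireLink }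

data EqGen {L : Set} (N M : Net L) : Set₁ where
  iso     : N ≅ M → EqGen N M
  flatten : ∀ p (A B : Set) → Rewrite (flatL p A B) (flatR p A B) N M → EqGen N M
  unit    : ∀ p → Rewrite (unitL p) unitR N M → EqGen N M

_≈_ : {L : Set} → Net L → Net L → Set₁
_≈_ = EqClosure EqGen

-- (ba): contraction (ctr) facing cocontraction (cctr).
-- Interface: inj₁ k = aux k of ctr, inj₂ k = aux k of cctr.
data BaCell : Set where
  ctr cctr : BaCell

baPol : BaCell → Pol
baPol ctr = qm
baPol cctr = bang

baLink : Port (Fin 2 ⊎ Fin 2) BaCell (λ _ → Fin 2) → Port (Fin 2 ⊎ Fin 2) BaCell (λ _ → Fin 2)
baLink (free (inj₁ k)) = aux ctr k
baLink (free (inj₂ k)) = aux cctr k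
baLink (prin ctr) = prin cctr
baLink (prin cctr) = prin ctr
baLink (aux ctr k) = free (inj₁ k)
baLink (aux cctr k) = free (inj₂ k)

baL : Net (Fin 2 ⊎ Fin 2)
baL = record { Cell = BaCell ; pol = baPol ; Aux = λ _ → Fin 2 ; link = baLink }

-- reduct: cocontractions inj₁ k (at the former aux k of ctr) and
-- contractions inj₂ j (at the former aux j of cctr), crosswise connected
baPol' : Fin 2 ⊎ Fin 2 → Pol
baPol' (inj₁ _) = bang
baPol' (inj₂ _) = qm

baLink' : Port (Fin 2 ⊎ Fin 2) (Fin 2 ⊎ Fin 2) (λ _ → Fin 2) → Port (Fin 2 ⊎ Fin 2) (Fin 2 ⊎ Fin 2) (λ _ → Fin 2)
baLink' (free (inj₁ k)) = prin (inj₁ k)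
baLink' (free (inj₂ j)) = prin (inj₂ j)
baLink' (prin (inj₁ k)) = free (inj₁ k)
baLink' (prin (inj₂ j)) = free (inj₂ j)
baLink' (aux (inj₁ k) j) = aux (inj₂ j) k
baLink' (aux (inj₂ j) k) = aux (inj₁ k) j

baR : Net (Fin 2 ⊎ Fin 2)
baR = record { Cell = Fin 2 ⊎ Fin 2 ; pol = baPol' ; Aux = λ _ → Fin 2 ; link = baLink' }

-- (s1)/(s2): a 0-ary p-cell (z) facing a binary (dual p)-cell (t)
-- becomes two 0-ary p-cells.  p = bang is (s1), p = qm is (s2).
-- Interface: k = aux k of t.
data SCell : Set where
  z t : SCell

module _ (p : Pol) where
  sPol : SCell → Pol
  sPol z = p
  sPol t = dual p

  sAux : SCell → Set
  sAux z = Fin 0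
  sAux t = Fin 2

  sLink : Port (Fin 2) SCell sAux → Port (Fin 2) SCell sAux
  sLink (free k) = aux t k
  sLink (prin z) = prin t
  sLink (prin t) = prin z
  sLink (aux z ())
  sLink (aux t k) = free k

  sL : Net (Fin 2)
  sL = record { Cell = SCell ; pol = sPol ; Aux = sAux ; link = sLink }

  sLink' : Port (Fin 2) (Fin 2) (λ _ → Fin 0) → Port (Fin 2) (Fin 2) (λ _ → Fin 0)
  sLink' (free k) = prin k
  sLink' (prin k) = free k
  sLink' (aux _ ())

  sR : Net (Fin 2)
  sR = record { Cell = Fin 2 ; pol = λ _ → p ; Aux = λ _ → Fin 0 ; link = sLink' }

ePol : SCell → Pol
ePol z = bang
ePol t = qm

eLink : Port ⊥ SCell (λ _ → Fin 0) → Port ⊥ SCell (λ _ → Fin 0)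
eLink (free ())
eLink (prin z) = prin t
eLink (prin t) = prin z
eLink (aux _ ())

εL : Net ⊥
εL = record { Cell = SCell ; pol = ePol ; Aux = λ _ → Fin 0 ; link = eLink }

eLink' : Port ⊥ ⊥ (λ _ → ⊥) → Port ⊥ ⊥ (λ _ → ⊥)
eLink' (free ())
eLink' (prin ())
eLink' (aux () _)

εR : Net ⊥
εR = record { Cell = ⊥ ; pol = λ () ; Aux = λ _ → ⊥ ; link = eLink' }

data Step {L : Set} (N M : Net L) : Set₁ where
  ba  : Rewrite baL baR N M → Step N M
  s   : ∀ p → Rewrite (sL p) (sR p) N M → Step N M
  eps : Rewrite εL εR N M → Step N M

_⇒*_ : {L : Set} → Net L → Net L → Set₁
_⇒*_ = Star (λ N M → N ≈ M ⊎ Step N M)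

-- Cell inj₁ i is the contraction tree of input i
-- (one ?-cell whose aux ports are the leaves), inj₂ o the cocontraction
-- tree of output o; the trees of i and o share R(i,o) wires.

module _ {I O : Set} (R : Multirel I O) where
  raPol : I ⊎ O → Pol
  raPol (inj₁ _) = qm
  raPol (inj₂ _) = bang

  raAux : I ⊎ O → Set
  raAux (inj₁ i) = Σ O λ o → Fin (R (i , o))
  raAux (inj₂ o) = Σ I λ i → Fin (R (i , o))

  raLink : Port (I ⊎ O) (I ⊎ O) raAux → Port (I ⊎ O) (I ⊎ O) raAux
  raLink (free l) = prin l
  raLink (prin l) = free l
  raLink (aux (inj₁ i) (o , k)) = aux (inj₂ o) (i , k)
  raLink (aux (inj₂ o) (i , k)) = aux (inj₁ i) (o , k)

  Routing : Net (I ⊎ O)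
  Routing = record { Cell = I ⊎ O ; pol = raPol ; Aux = raAux ; link = raLink }

_∖_ : (n : ℕ) → Fin n → Set
n ∖ x = Σ (Fin n) λ j → False (j ≟ x)

del : {n : ℕ} (x : Fin n) → Fin n → (n ∖ x) ⊎ ⊤
del x j with j ≟ x
... | yes _ = inj₂ tt
... | no ¬p = inj₁ (j , fromWitnessFalse ¬p)

undel : {n : ℕ} (x : Fin n) → (n ∖ x) ⊎ ⊤ → Fin n
undel x (inj₁ (j , _)) = j
undel x (inj₂ tt) = x

module _ {a b a' b' : ℕ} (R : Multirel (Fin a) (Fin b)) (o : Fin b)
         (S : Multirel (Fin a') (Fin b')) (i : Fin a') where
  f₁ : Fin a ⊎ Fin b → (Fin a ⊎ (b ∖ o)) ⊎ ⊤
  f₁ (inj₁ x) = inj₁ (inj₁ x)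
  f₁ (inj₂ y) = [ (λ y' → inj₁ (inj₂ y')) , inj₂ ] (del o y)

  g₁ : (Fin a ⊎ (b ∖ o)) ⊎ ⊤ → Fin a ⊎ Fin b
  g₁ (inj₁ (inj₁ x)) = inj₁ x
  g₁ (inj₁ (inj₂ y)) = inj₂ (undel o (inj₁ y))
  g₁ (inj₂ tt) = inj₂ o

  f₂ : Fin a' ⊎ Fin b' → ((a' ∖ i) ⊎ Fin b') ⊎ ⊤
  f₂ (inj₁ x) = [ (λ x' → inj₁ (inj₁ x')) , inj₂ ] (del i x)
  f₂ (inj₂ y) = inj₁ (inj₂ y)

  g₂ : ((a' ∖ i) ⊎ Fin b') ⊎ ⊤ → Fin a' ⊎ Fin b'
  g₂ (inj₁ (inj₁ x)) = inj₁ (undel i (inj₁ x))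
  g₂ (inj₁ (inj₂ y)) = inj₂ y
  g₂ (inj₂ tt) = inj₁ i

  shuf : {A B C D : Set} → (A ⊎ B) ⊎ (C ⊎ D) → (A ⊎ C) ⊎ (B ⊎ D)
  shuf (inj₁ (inj₁ x)) = inj₁ (inj₁ x)
  shuf (inj₁ (inj₂ x)) = inj₂ (inj₁ x)
  shuf (inj₂ (inj₁ x)) = inj₁ (inj₂ x)
  shuf (inj₂ (inj₂ x)) = inj₂ (inj₂ x)

  connect : Net ((Fin a ⊎ (a' ∖ i)) ⊎ ((b ∖ o) ⊎ Fin b'))
  connect = rename shuf shuf
    (glue (rename f₁ g₁ (Routing R)) (rename f₂ g₂ (Routing S)))

-- Connecting o to i makes the cocontraction tree of o face the contraction tree
-- of i.  Repeated (ba), (s1), (s2) and (ε) steps turn this pair into a complete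
-- bipartite net: a cocontraction on each wire leaving the tree of i and a
-- contraction on each wire entering the tree of o, every such contraction joined
-- to every such cocontraction.  Each new contraction hangs below the contraction
-- tree of the input x of R its wire comes from and merges into it by
-- associativity; dually each new cocontraction merges into the cocontraction tree
-- of an output y of S.  What remains is a routing area joining x to y by
-- R(x,o) * S(i,y) wires, one for each path x → o = i → y.
module Submission where

open import Defs
open import Data.Nat using (ℕ; zero; suc; _+_; _*_)
open import Data.Fin using (Fin; zero; suc; _≟_; combine; remQuot)
open import Data.Fin.Properties using (+↔⊎; combine-remQuot; remQuot-combine)
open import Data.Empty using (⊥; ⊥-elim)
open import Data.Unit using (⊤; tt)
open import Data.Bool.Properties using (T-irrelevant)
open import Data.Sum using (_⊎_; inj₁; inj₂; [_,_])
open import Data.Sum.Function.Propositional using (_⊎-↔_)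
open import Data.Product using (Σ; ∃; _×_; _,_; proj₁; proj₂)
open import Function using (id)
open import Function.Bundles using (_↔_; Inverse; mk↔ₛ′)
open import Function.Properties.Inverse using (↔-refl; ↔-sym; ↔-trans)
open import Relation.Nullary using (Dec; yes; no)
open import Relation.Nullary.Decidable using (fromWitnessFalse; toWitnessFalse)
open import Relation.Binary.PropositionalEquality using (_≡_; refl; sym; trans; cong)
open import Relation.Binary.Construct.Closure.ReflexiveTransitive using (Star; ε; _◅_; _◅◅_)
open import Relation.Binary.Construct.Closure.Symmetric using (fwd; bwd)

open Net

-- A net with a hole of interface X, presented so that no wire joins two
-- hole ports: following a wire from a context port ends at a context port
-- or at a hole label.
record Context (L X : Set) : Set₁ where
  field
    CCell       : Set
    cpol        : CCell → Pol
    CAux        : CCell → Set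
    partner     : Port L CCell CAux → Port L CCell CAux ⊎ X
    holePartner : X → Port L CCell CAux

module Plugging {L X : Set} (K : Context L X) (Q : Net X) where
  open Context K

  Cells : Set
  Cells = CCell ⊎ Cell Q

  Auxes : Cells → Set
  Auxes (inj₁ c) = CAux c
  Auxes (inj₂ c) = Aux Q c

  Ports : Set
  Ports = Port L Cells Auxes

  fromContext : Port L CCell CAux → Ports
  fromContext (free l) = free l
  fromContext (prin c) = prin (inj₁ c)
  fromContext (aux c a) = aux (inj₁ c) a

  fromInner : Port X (Cell Q) (Aux Q) → Ports
  fromInner (free x) = fromContext (holePartner x)
  fromInner (prin c) = prin (inj₂ c)
  fromInner (aux c a) = aux (inj₂ c) a

  follow : Port L CCell CAux ⊎ X → Ports
  follow (inj₁ v) = fromContext v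
  follow (inj₂ x) = fromInner (link Q (free x))

  wiring : Ports → Ports
  wiring (free l) = follow (partner (free l))
  wiring (prin (inj₁ c)) = follow (partner (prin c))
  wiring (aux (inj₁ c) a) = follow (partner (aux c a))
  wiring (prin (inj₂ c)) = fromInner (link Q (prin c))
  wiring (aux (inj₂ c) a) = fromInner (link Q (aux c a))

  polarity : Cells → Pol
  polarity (inj₁ c) = cpol c
  polarity (inj₂ c) = pol Q c

  net : Net L
  net = record { Cell = Cells ; pol = polarity ; Aux = Auxes ; link = wiring }

plug : {L X : Set} → Context L X → Net X → Net L
plug = Plugging.net

module ContextNet {L X : Set} (K : Context L X) where
  open Context K

  reach : Port L CCell CAux ⊎ X → Port (L ⊎ X) CCell CAux
  reach (inj₁ v) = mapPort inj₁ v
  reach (inj₂ x) = free (inj₂ x)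

  wiring : Port (L ⊎ X) CCell CAux → Port (L ⊎ X) CCell CAux
  wiring (free (inj₁ l)) = reach (partner (free l))
  wiring (free (inj₂ x)) = mapPort inj₁ (holePartner x)
  wiring (prin c) = reach (partner (prin c))
  wiring (aux c a) = reach (partner (aux c a))

  asNet : Net (L ⊎ X)
  asNet = record { Cell = CCell ; pol = cpol ; Aux = CAux ; link = wiring }

  asNet-noXX : NoXX asNet
  asNet-noXX x y e with holePartner x | e
  ... | free l | ()
  ... | prin c | ()
  ... | aux c a | ()

module _ {L : Set} where
  ≅-refl : {N : Net L} → N ≅ N
  ≅-refl {N} = record
    { cellIso = ↔-refl ; auxIso = λ c → ↔-refl ; polEq = λ c → refl
    ; linkEq = λ p → trans (cong (link N) (portMap-id p)) (sym (portMap-id (link N p))) }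
    where
    portMap-id : ∀ p → portMap N N ↔-refl (λ c → ↔-refl) p ≡ p
    portMap-id (free l) = refl
    portMap-id (prin c) = refl
    portMap-id (aux c x) = refl

  ≅-trans : {N M P : Net L} → N ≅ M → M ≅ P → N ≅ P
  ≅-trans {N} {M} {P} e₁ e₂ = record
    { cellIso = ↔-trans f g
    ; auxIso = λ c → ↔-trans (a c) (b (Inverse.to f c))
    ; polEq = λ c → trans (_≅_.polEq e₂ (Inverse.to f c)) (_≅_.polEq e₁ c)
    ; linkEq = λ p → trans (cong (link P) (portMap-∘ p))
                     (trans (_≅_.linkEq e₂ (portMap N M f a p))
                     (trans (cong (portMap M P g b) (_≅_.linkEq e₁ p))
                      (sym (portMap-∘ (link N p))))) }
    where
    f : Cell N ↔ Cell M
    f = _≅_.cellIso e₁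
    a : ∀ c → Aux N c ↔ Aux M (Inverse.to f c)
    a = _≅_.auxIso e₁
    g : Cell M ↔ Cell P
    g = _≅_.cellIso e₂
    b : ∀ c → Aux M c ↔ Aux P (Inverse.to g c)
    b = _≅_.auxIso e₂
    portMap-∘ : ∀ p → portMap N P (↔-trans f g) (λ c → ↔-trans (a c) (b (Inverse.to f c))) p
                    ≡ portMap M P g b (portMap N M f a p)
    portMap-∘ (free l) = refl
    portMap-∘ (prin c) = refl
    portMap-∘ (aux c x) = refl

module PlugIsGlue {L X : Set} (K : Context L X) (Q : Net X) where
  open Context K
  open Plugging K Q
  open ContextNet K using (asNet; reach)
  open Glue asNet (lift Q) using (Ax; resolve; hop₁; hop₂; emb₁; emb₂; Pt)

  auxes : (c : Cells) → Auxes c ↔ Ax c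
  auxes (inj₁ c) = ↔-refl
  auxes (inj₂ c) = ↔-refl

  ports : Ports → Port L Cells Ax
  ports = portMap net (close (glue asNet (lift Q))) ↔-refl auxes

  closePort : Pt → Port L Cells Ax
  closePort = mapPort [ id , ⊥-elim ]

  resolve-inner : ∀ (p : Pt) q →
    closePort (resolve p hop₁ hop₂ (emb₂ (mapPort inj₂ q))) ≡ ports (fromInner q)
  resolve-inner p (free x) with holePartner x
  ... | free l = refl
  ... | prin c = refl
  ... | aux c a = refl
  resolve-inner p (prin c) = refl
  resolve-inner p (aux c a) = refl

  resolve-context : ∀ (p : Pt) r →
    closePort (resolve p hop₂ hop₁ (emb₁ (reach r))) ≡ ports (follow r)
  resolve-context p (inj₁ (free l)) = refl
  resolve-context p (inj₁ (prin c)) = refl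
  resolve-context p (inj₁ (aux c a)) = refl
  resolve-context p (inj₂ x) with link Q (free x)
  ... | prin c = refl
  ... | aux c a = refl
  ... | free x' with holePartner x'
  ...   | free l = refl
  ...   | prin c = refl
  ...   | aux c a = refl

  plug≅glue : plug K Q ≅ close (glue asNet (lift Q))
  plug≅glue = record
    { cellIso = ↔-refl ; auxIso = auxes
    ; polEq = λ { (inj₁ c) → refl ; (inj₂ c) → refl }
    ; linkEq = λ
      { (free l) → resolve-context _ (partner (free l))
      ; (prin (inj₁ c)) → resolve-context _ (partner (prin c))
      ; (aux (inj₁ c) a) → resolve-context _ (partner (aux c a))
      ; (prin (inj₂ c)) → resolve-inner _ (link Q (prin c))
      ; (aux (inj₂ c) a) → resolve-inner _ (link Q (aux c a)) } }

open PlugIsGlue using (plug≅glue)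

data Rule : {X : Set} → Net X → Net X → Set₁ where
  ba-rule        : Rule baL baR
  s-rule         : ∀ p → Rule (sL p) (sR p)
  ε-rule         : Rule εL εR
  flatten-rule   : ∀ p A B → Rule (flatL p A B) (flatR p A B)

  unflatten-rule : ∀ p A B → Rule (flatR p A B) (flatL p A B)

data Move {L : Set} (N M : Net L) : Set₁ where
  by-iso  : N ≅ M → Move N M

  by-rule : ∀ {X} {Q Q' : Net X} → Rule Q Q' → (K : Context L X) →
            N ≅ plug K Q → M ≅ plug K Q' → Move N M

_⇛_ : {L : Set} → Net L → Net L → Set₁
_⇛_ = Star Move

move⇒* : {L : Set} {N M : Net L} → Move N M → N ⇒* M
move⇒* (by-iso e) = inj₁ (fwd (iso e) ◅ ε) ◅ ε
move⇒* {N = N} {M} (by-rule {Q = Q} {Q'} r K e e') = rewrite-by r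
  where
  open ContextNet K using (asNet; asNet-noXX)

  forward : Rewrite Q Q' N M
  forward = asNet , asNet-noXX , ≅-trans e (plug≅glue K Q) , ≅-trans e' (plug≅glue K Q')

  backward : Rewrite Q' Q M N
  backward = asNet , asNet-noXX , ≅-trans e' (plug≅glue K Q') , ≅-trans e (plug≅glue K Q)

  rewrite-by : Rule Q Q' → N ⇒* M
  rewrite-by ba-rule = inj₂ (ba forward) ◅ ε
  rewrite-by (s-rule p) = inj₂ (s p forward) ◅ ε
  rewrite-by ε-rule = inj₂ (eps forward) ◅ ε
  rewrite-by (flatten-rule p A B) = inj₁ (fwd (flatten p A B forward) ◅ ε) ◅ ε
  rewrite-by (unflatten-rule p A B) = inj₁ (bwd (flatten p A B backward) ◅ ε) ◅ ε

⇛⇒⇒* : {L : Set} {N M : Net L} → N ⇛ M → N ⇒* M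
⇛⇒⇒* ε = ε
⇛⇒⇒* (m ◅ ms) = move⇒* m ◅◅ ⇛⇒⇒* ms

≅⇒⇛ : {L : Set} {N M : Net L} → N ≅ M → N ⇛ M
≅⇒⇛ e = by-iso e ◅ ε

rule⇛ : {L X : Set} {N : Net L} {Q Q' : Net X} → Rule Q Q' → (K : Context L X) →
        N ≅ plug K Q → N ⇛ plug K Q'
rule⇛ r K e = by-rule r K e ≅-refl ◅ ε

module PlugCong {L X : Set} (K : Context L X) {N N' : Net X} (e : N ≅ N') where
  open Context K
  module A = Plugging K N
  module B = Plugging K N'

  f : Cell N ↔ Cell N'
  f = _≅_.cellIso e

  a : ∀ c → Aux N c ↔ Aux N' (Inverse.to f c)
  a = _≅_.auxIso e

  toCell : A.Cells → B.Cells
  toCell (inj₁ c) = inj₁ c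
  toCell (inj₂ c) = inj₂ (Inverse.to f c)

  fromCell : B.Cells → A.Cells
  fromCell (inj₁ c) = inj₁ c
  fromCell (inj₂ c) = inj₂ (Inverse.from f c)

  cells : A.Cells ↔ B.Cells
  cells = mk↔ₛ′ toCell fromCell
    (λ { (inj₁ c) → refl ; (inj₂ c) → cong inj₂ (Inverse.strictlyInverseˡ f c) })
    (λ { (inj₁ c) → refl ; (inj₂ c) → cong inj₂ (Inverse.strictlyInverseʳ f c) })

  auxes : (c : A.Cells) → A.Auxes c ↔ B.Auxes (toCell c)
  auxes (inj₁ c) = ↔-refl
  auxes (inj₂ c) = a c

  ports : A.Ports → B.Ports
  ports = portMap (plug K N) (plug K N') cells auxes

  inner : Port X (Cell N) (Aux N) → Port X (Cell N') (Aux N')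
  inner = portMap N N' f a

  ports-context : ∀ v → ports (A.fromContext v) ≡ B.fromContext v
  ports-context (free l) = refl
  ports-context (prin c) = refl
  ports-context (aux c x) = refl

  ports-inner : ∀ q → ports (A.fromInner q) ≡ B.fromInner (inner q)
  ports-inner (free x) = ports-context (holePartner x)
  ports-inner (prin c) = refl
  ports-inner (aux c x) = refl

  ports-follow : ∀ r → ports (A.follow r) ≡ B.follow r
  ports-follow (inj₁ v) = ports-context v
  ports-follow (inj₂ x) = trans (ports-inner (link N (free x)))
                                (cong B.fromInner (sym (_≅_.linkEq e (free x))))

  ports-link : ∀ q → B.fromInner (link N' (inner q)) ≡ ports (A.fromInner (link N q))
  ports-link q = trans (cong B.fromInner (_≅_.linkEq e q)) (sym (ports-inner (link N q)))

  plug-cong : plug K N ≅ plug K N'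
  plug-cong = record
    { cellIso = cells ; auxIso = auxes
    ; polEq = λ { (inj₁ c) → refl ; (inj₂ c) → _≅_.polEq e c }
    ; linkEq = λ
      { (free l) → sym (ports-follow (partner (free l)))
      ; (prin (inj₁ c)) → sym (ports-follow (partner (prin c)))
      ; (aux (inj₁ c) x) → sym (ports-follow (partner (aux c x)))
      ; (prin (inj₂ c)) → ports-link (prin c)
      ; (aux (inj₂ c) x) → ports-link (aux c x) } }

open PlugCong using (plug-cong)

module Compose {L X Y : Set} (K₀ : Context L X) (K₁ : Context X Y) where
  module K₀ = Context K₀
  module K₁ = Context K₁

  Cells : Set
  Cells = K₀.CCell ⊎ K₁.CCell

  Auxes : Cells → Set
  Auxes (inj₁ c) = K₀.CAux c
  Auxes (inj₂ c) = K₁.CAux c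

  polarity : Cells → Pol
  polarity (inj₁ c) = K₀.cpol c
  polarity (inj₂ c) = K₁.cpol c

  Ports : Set
  Ports = Port L Cells Auxes

  outer : Port L K₀.CCell K₀.CAux → Ports
  outer (free l) = free l
  outer (prin c) = prin (inj₁ c)
  outer (aux c x) = aux (inj₁ c) x

  inner : Port X K₁.CCell K₁.CAux → Ports
  inner (free x) = outer (K₀.holePartner x)
  inner (prin c) = prin (inj₂ c)
  inner (aux c x) = aux (inj₂ c) x

  follow₁ : Port X K₁.CCell K₁.CAux ⊎ Y → Ports ⊎ Y
  follow₁ (inj₁ v) = inj₁ (inner v)
  follow₁ (inj₂ y) = inj₂ y

  follow₀ : Port L K₀.CCell K₀.CAux ⊎ X → Ports ⊎ Y
  follow₀ (inj₁ v) = inj₁ (outer v)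
  follow₀ (inj₂ x) = follow₁ (K₁.partner (free x))

  partner : Ports → Ports ⊎ Y
  partner (free l) = follow₀ (K₀.partner (free l))
  partner (prin (inj₁ c)) = follow₀ (K₀.partner (prin c))
  partner (aux (inj₁ c) x) = follow₀ (K₀.partner (aux c x))
  partner (prin (inj₂ c)) = follow₁ (K₁.partner (prin c))
  partner (aux (inj₂ c) x) = follow₁ (K₁.partner (aux c x))

  composite : Context L Y
  composite = record { CCell = Cells ; cpol = polarity ; CAux = Auxes ; partner = partner
                     ; holePartner = λ y → inner (K₁.holePartner y) }

_∘ᶜ_ : {L X Y : Set} → Context L X → Context X Y → Context L Y
K₀ ∘ᶜ K₁ = Compose.composite K₀ K₁

module PlugAssoc {L X Y : Set} (K₀ : Context L X) (K₁ : Context X Y) (Q : Net Y) where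
  open Compose K₀ K₁ using (outer; inner; follow₀; follow₁)
  module K₀ = Context K₀
  module K₁ = Context K₁
  module In = Plugging K₁ Q
  module Out = Plugging K₀ (plug K₁ Q)
  module Comp = Plugging (K₀ ∘ᶜ K₁) Q

  toCell : Out.Cells → Comp.Cells
  toCell (inj₁ c) = inj₁ (inj₁ c)
  toCell (inj₂ (inj₁ c)) = inj₁ (inj₂ c)
  toCell (inj₂ (inj₂ c)) = inj₂ c

  fromCell : Comp.Cells → Out.Cells
  fromCell (inj₁ (inj₁ c)) = inj₁ c
  fromCell (inj₁ (inj₂ c)) = inj₂ (inj₁ c)
  fromCell (inj₂ c) = inj₂ (inj₂ c)

  cells : Out.Cells ↔ Comp.Cells
  cells = mk↔ₛ′ toCell fromCell
    (λ { (inj₁ (inj₁ c)) → refl ; (inj₁ (inj₂ c)) → refl ; (inj₂ c) → refl })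
    (λ { (inj₁ c) → refl ; (inj₂ (inj₁ c)) → refl ; (inj₂ (inj₂ c)) → refl })

  auxes : (c : Out.Cells) → Out.Auxes c ↔ Comp.Auxes (toCell c)
  auxes (inj₁ c) = ↔-refl
  auxes (inj₂ (inj₁ c)) = ↔-refl
  auxes (inj₂ (inj₂ c)) = ↔-refl

  ports : Out.Ports → Comp.Ports
  ports = portMap (plug K₀ (plug K₁ Q)) (plug (K₀ ∘ᶜ K₁) Q) cells auxes

  ports-outer : ∀ w → ports (Out.fromContext w) ≡ Comp.fromContext (outer w)
  ports-outer (free l) = refl
  ports-outer (prin c) = refl
  ports-outer (aux c x) = refl

  ports-middle : ∀ w → ports (Out.fromInner (In.fromContext w)) ≡ Comp.fromContext (inner w)
  ports-middle (free x) = ports-outer (K₀.holePartner x)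
  ports-middle (prin c) = refl
  ports-middle (aux c x) = refl

  ports-inner : ∀ q → ports (Out.fromInner (In.fromInner q)) ≡ Comp.fromInner q
  ports-inner (free y) = ports-middle (K₁.holePartner y)
  ports-inner (prin c) = refl
  ports-inner (aux c x) = refl

  ports-follow₁ : ∀ r → ports (Out.fromInner (In.follow r)) ≡ Comp.follow (follow₁ r)
  ports-follow₁ (inj₁ v) = ports-middle v
  ports-follow₁ (inj₂ y) = ports-inner (link Q (free y))

  ports-follow₀ : ∀ r → ports (Out.follow r) ≡ Comp.follow (follow₀ r)
  ports-follow₀ (inj₁ v) = ports-outer v
  ports-follow₀ (inj₂ x) = ports-follow₁ (K₁.partner (free x))

  plug-assoc : plug K₀ (plug K₁ Q) ≅ plug (K₀ ∘ᶜ K₁) Q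
  plug-assoc = record
    { cellIso = cells ; auxIso = auxes
    ; polEq = λ { (inj₁ c) → refl ; (inj₂ (inj₁ c)) → refl ; (inj₂ (inj₂ c)) → refl }
    ; linkEq = λ
      { (free l) → sym (ports-follow₀ (K₀.partner (free l)))
      ; (prin (inj₁ c)) → sym (ports-follow₀ (K₀.partner (prin c)))
      ; (aux (inj₁ c) x) → sym (ports-follow₀ (K₀.partner (aux c x)))
      ; (prin (inj₂ (inj₁ c))) → sym (ports-follow₁ (K₁.partner (prin c)))
      ; (aux (inj₂ (inj₁ c)) x) → sym (ports-follow₁ (K₁.partner (aux c x)))
      ; (prin (inj₂ (inj₂ c))) → sym (ports-inner (link Q (prin c)))
      ; (aux (inj₂ (inj₂ c)) x) → sym (ports-inner (link Q (aux c x))) } }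

open PlugAssoc using (plug-assoc)

plug-move : {L X : Set} (K : Context L X) {N M : Net X} → Move N M → Move (plug K N) (plug K M)
plug-move K (by-iso e) = by-iso (plug-cong K e)
plug-move K (by-rule {Q = Q} {Q'} r K₁ e e') =
  by-rule r (K ∘ᶜ K₁) (≅-trans (plug-cong K e) (plug-assoc K K₁ Q))
                      (≅-trans (plug-cong K e') (plug-assoc K K₁ Q'))

plug-⇛ : {L X : Set} (K : Context L X) {N M : Net X} → N ⇛ M → plug K N ⇛ plug K M
plug-⇛ K ε = ε
plug-⇛ K (m ◅ ms) = plug-move K m ◅ plug-⇛ K ms

idᶜ : {X : Set} → Context X X
idᶜ {X} = record { CCell = ⊥ ; cpol = λ () ; CAux = λ () ; partner = partner ; holePartner = free }
  where

  partner : Port X ⊥ (λ ()) → Port X ⊥ (λ ()) ⊎ X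
  partner (free x) = inj₂ x

module PlugId {X : Set} (Q : Net X) where
  module P = Plugging idᶜ Q

  cells : Cell Q ↔ P.Cells
  cells = mk↔ₛ′ inj₂ (λ { (inj₁ ()) ; (inj₂ c) → c }) (λ { (inj₁ ()) ; (inj₂ c) → refl }) (λ c → refl)

  ports : Port X (Cell Q) (Aux Q) → P.Ports
  ports = portMap Q (plug idᶜ Q) cells (λ c → ↔-refl)

  ports-inner : ∀ q → P.fromInner q ≡ ports q
  ports-inner (free x) = refl
  ports-inner (prin c) = refl
  ports-inner (aux c y) = refl

  plug-id : Q ≅ plug idᶜ Q
  plug-id = record
    { cellIso = cells ; auxIso = λ c → ↔-refl ; polEq = λ c → refl
    ; linkEq = λ { (free x) → ports-inner (link Q (free x))
                 ; (prin c) → ports-inner (link Q (prin c))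
                 ; (aux c y) → ports-inner (link Q (aux c y)) } }

open PlugId using (plug-id)

rule-at-top⇛ : {X : Set} {Q Q' : Net X} → Rule Q Q' → Q ⇛ plug idᶜ Q'
rule-at-top⇛ {Q = Q} r = rule⇛ r idᶜ (plug-id Q)

module DisjointUnion {n : ℕ} (X : Fin n → Set) (N : (a : Fin n) → Net (X a)) where
  Cells : Set
  Cells = Σ (Fin n) (λ a → Cell (N a))

  Auxes : Cells → Set
  Auxes (a , c) = Aux (N a) c

  polarity : Cells → Pol
  polarity (a , c) = pol (N a) c

  tag : (a : Fin n) → Port (X a) (Cell (N a)) (Aux (N a)) → Port (Σ (Fin n) X) Cells Auxes
  tag a (free x) = free (a , x)
  tag a (prin c) = prin (a , c)
  tag a (aux c y) = aux (a , c) y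

  wiring : Port (Σ (Fin n) X) Cells Auxes → Port (Σ (Fin n) X) Cells Auxes
  wiring (free (a , x)) = tag a (link (N a) (free x))
  wiring (prin (a , c)) = tag a (link (N a) (prin c))
  wiring (aux (a , c) y) = tag a (link (N a) (aux c y))

  net : Net (Σ (Fin n) X)
  net = record { Cell = Cells ; pol = polarity ; Aux = Auxes ; link = wiring }

Disjoint : {n : ℕ} (X : Fin n → Set) (N : (a : Fin n) → Net (X a)) → Net (Σ (Fin n) X)
Disjoint = DisjointUnion.net

module HeadAndTail {n : ℕ} (X : Fin (suc n) → Set) where
  Labels : Set
  Labels = Σ (Fin (suc n)) X

  Tail : Fin n → Set
  Tail a = X (suc a)

  tailLabel : Σ (Fin n) Tail → Labels
  tailLabel (a , x) = (suc a , x)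

  headLabel : X zero → Labels
  headLabel x = (zero , x)

  tail-around : Net (Σ (Fin n) Tail) → Context Labels (X zero)
  tail-around T = record { CCell = Cell T ; cpol = pol T ; CAux = Aux T
                         ; partner = partner ; holePartner = λ x → free (zero , x) }
    where
    partner : Port Labels (Cell T) (Aux T) → Port Labels (Cell T) (Aux T) ⊎ X zero
    partner (free (zero , x)) = inj₂ x
    partner (free (suc a , x)) = inj₁ (mapPort tailLabel (link T (free (a , x))))
    partner (prin c) = inj₁ (mapPort tailLabel (link T (prin c)))
    partner (aux c y) = inj₁ (mapPort tailLabel (link T (aux c y)))

  head-around : Net (X zero) → Context Labels (Σ (Fin n) Tail)
  head-around H = record { CCell = Cell H ; cpol = pol H ; CAux = Aux H
                         ; partner = partner ; holePartner = λ { (a , x) → free (suc a , x) } }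
    where
    partner : Port Labels (Cell H) (Aux H) → Port Labels (Cell H) (Aux H) ⊎ Σ (Fin n) Tail
    partner (free (zero , x)) = inj₁ (mapPort headLabel (link H (free x)))
    partner (free (suc a , x)) = inj₂ (a , x)
    partner (prin c) = inj₁ (mapPort headLabel (link H (prin c)))
    partner (aux c y) = inj₁ (mapPort headLabel (link H (aux c y)))

  module Swap (H : Net (X zero)) (T : Net (Σ (Fin n) Tail)) where
    module A = Plugging (head-around H) T
    module B = Plugging (tail-around T) H

    swap : A.Cells → B.Cells
    swap (inj₁ c) = inj₂ c
    swap (inj₂ c) = inj₁ c

    unswap : B.Cells → A.Cells
    unswap (inj₁ c) = inj₂ c
    unswap (inj₂ c) = inj₁ c

    cells : A.Cells ↔ B.Cells
    cells = mk↔ₛ′ swap unswap (λ { (inj₁ c) → refl ; (inj₂ c) → refl }) (λ { (inj₁ c) → refl ; (inj₂ c) → refl })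

    auxes : (c : A.Cells) → A.Auxes c ↔ B.Auxes (swap c)
    auxes (inj₁ c) = ↔-refl
    auxes (inj₂ c) = ↔-refl

    ports : A.Ports → B.Ports
    ports = portMap (plug (head-around H) T) (plug (tail-around T) H) cells auxes

    ports-head : ∀ q → ports (A.fromContext (mapPort headLabel q)) ≡ B.fromInner q
    ports-head (free x) = refl
    ports-head (prin c) = refl
    ports-head (aux c y) = refl

    ports-tail : ∀ q → ports (A.fromInner q) ≡ B.fromContext (mapPort tailLabel q)
    ports-tail (free x) = refl
    ports-tail (prin c) = refl
    ports-tail (aux c y) = refl

    swap-around : plug (head-around H) T ≅ plug (tail-around T) H
    swap-around = record
      { cellIso = cells ; auxIso = auxes
      ; polEq = λ { (inj₁ c) → refl ; (inj₂ c) → refl }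
      ; linkEq = λ
        { (free (zero , x)) → sym (ports-head (link H (free x)))
        ; (free (suc a , x)) → sym (ports-tail (link T (free (a , x))))
        ; (prin (inj₁ c)) → sym (ports-head (link H (prin c)))
        ; (aux (inj₁ c) y) → sym (ports-head (link H (aux c y)))
        ; (prin (inj₂ c)) → sym (ports-tail (link T (prin c)))
        ; (aux (inj₂ c) y) → sym (ports-tail (link T (aux c y))) } }

  module Split (N : (a : Fin (suc n)) → Net (X a)) where
    Ns : (a : Fin n) → Net (Tail a)
    Ns a = N (suc a)
    module D = DisjointUnion X N
    module Ds = DisjointUnion Tail Ns
    module A = Plugging (head-around (N zero)) (Disjoint Tail Ns)
    module B = Plugging (tail-around (Disjoint Tail Ns)) (N zero)

    toA : D.Cells → A.Cells
    toA (zero , c) = inj₁ c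
    toA (suc a , c) = inj₂ (a , c)

    fromA : A.Cells → D.Cells
    fromA (inj₁ c) = (zero , c)
    fromA (inj₂ (a , c)) = (suc a , c)

    cellsA : D.Cells ↔ A.Cells
    cellsA = mk↔ₛ′ toA fromA (λ { (inj₁ c) → refl ; (inj₂ (a , c)) → refl })
                             (λ { (zero , c) → refl ; (suc a , c) → refl })

    auxesA : (c : D.Cells) → D.Auxes c ↔ A.Auxes (toA c)
    auxesA (zero , c) = ↔-refl
    auxesA (suc a , c) = ↔-refl

    portsA : Port Labels D.Cells D.Auxes → A.Ports
    portsA = portMap (Disjoint X N) (plug (head-around (N zero)) (Disjoint Tail Ns)) cellsA auxesA

    portsA-head : ∀ q → A.fromContext (mapPort headLabel q) ≡ portsA (D.tag zero q)
    portsA-head (free x) = refl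
    portsA-head (prin c) = refl
    portsA-head (aux c y) = refl

    portsA-tail : ∀ a q → A.fromInner (Ds.tag a q) ≡ portsA (D.tag (suc a) q)
    portsA-tail a (free x) = refl
    portsA-tail a (prin c) = refl
    portsA-tail a (aux c y) = refl

    disjoint≅head-around : Disjoint X N ≅ plug (head-around (N zero)) (Disjoint Tail Ns)
    disjoint≅head-around = record
      { cellIso = cellsA ; auxIso = auxesA
      ; polEq = λ { (zero , c) → refl ; (suc a , c) → refl }
      ; linkEq = λ
        { (free (zero , x)) → portsA-head (link (N zero) (free x))
        ; (free (suc a , x)) → portsA-tail a (link (N (suc a)) (free x))
        ; (prin (zero , c)) → portsA-head (link (N zero) (prin c))
        ; (prin (suc a , c)) → portsA-tail a (link (N (suc a)) (prin c))
        ; (aux (zero , c) y) → portsA-head (link (N zero) (aux c y))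
        ; (aux (suc a , c) y) → portsA-tail a (link (N (suc a)) (aux c y)) } }

    toD : B.Cells → D.Cells
    toD (inj₂ c) = (zero , c)
    toD (inj₁ (a , c)) = (suc a , c)

    fromD : D.Cells → B.Cells
    fromD (zero , c) = inj₂ c
    fromD (suc a , c) = inj₁ (a , c)

    cellsB : B.Cells ↔ D.Cells
    cellsB = mk↔ₛ′ toD fromD (λ { (zero , c) → refl ; (suc a , c) → refl })
                             (λ { (inj₂ c) → refl ; (inj₁ (a , c)) → refl })

    auxesB : (c : B.Cells) → B.Auxes c ↔ D.Auxes (toD c)
    auxesB (inj₁ (a , c)) = ↔-refl
    auxesB (inj₂ c) = ↔-refl

    portsB : B.Ports → Port Labels D.Cells D.Auxes
    portsB = portMap (plug (tail-around (Disjoint Tail Ns)) (N zero)) (Disjoint X N) cellsB auxesB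

    portsB-head : ∀ q → D.tag zero q ≡ portsB (B.fromInner q)
    portsB-head (free x) = refl
    portsB-head (prin c) = refl
    portsB-head (aux c y) = refl

    portsB-tail : ∀ a q → D.tag (suc a) q ≡ portsB (B.fromContext (mapPort tailLabel (Ds.tag a q)))
    portsB-tail a (free x) = refl
    portsB-tail a (prin c) = refl
    portsB-tail a (aux c y) = refl

    tail-around≅disjoint : plug (tail-around (Disjoint Tail Ns)) (N zero) ≅ Disjoint X N
    tail-around≅disjoint = record
      { cellIso = cellsB ; auxIso = auxesB
      ; polEq = λ { (inj₂ c) → refl ; (inj₁ (a , c)) → refl }
      ; linkEq = λ
        { (free (zero , x)) → portsB-head (link (N zero) (free x))
        ; (free (suc a , x)) → portsB-tail a (link (N (suc a)) (free x))
        ; (prin (inj₂ c)) → portsB-head (link (N zero) (prin c))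
        ; (aux (inj₂ c) y) → portsB-head (link (N zero) (aux c y))
        ; (prin (inj₁ (a , c))) → portsB-tail a (link (N (suc a)) (prin c))
        ; (aux (inj₁ (a , c)) y) → portsB-tail a (link (N (suc a)) (aux c y)) } }

disjoint-empty : (X : Fin 0 → Set) (N N' : (a : Fin 0) → Net (X a)) → Disjoint X N ≅ Disjoint X N'
disjoint-empty X N N' = record
  { cellIso = mk↔ₛ′ (λ { (() , _) }) (λ { (() , _) }) (λ { (() , _) }) (λ { (() , _) })
  ; auxIso = λ { (() , _) } ; polEq = λ { (() , _) }
  ; linkEq = λ { (free (() , _)) ; (prin (() , _)) ; (aux (() , _) _) } }

-- Reduce the head with the reduced tail as context, after swapping roles.
disjoint-⇛ : (n : ℕ) (X : Fin n → Set) (N N' : (a : Fin n) → Net (X a)) →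
             ((a : Fin n) → N a ⇛ N' a) → Disjoint X N ⇛ Disjoint X N'
disjoint-⇛ zero X N N' r = ≅⇒⇛ (disjoint-empty X N N')
disjoint-⇛ (suc n) X N N' r =
  ≅⇒⇛ (Split.disjoint≅head-around N)
  ◅◅ plug-⇛ (head-around (N zero)) (disjoint-⇛ n Tail (λ a → N (suc a)) (λ a → N' (suc a)) (λ a → r (suc a)))
  ◅◅ ≅⇒⇛ (Swap.swap-around (N zero) (Disjoint Tail (λ a → N' (suc a))))
  ◅◅ plug-⇛ (tail-around (Disjoint Tail (λ a → N' (suc a)))) (r zero)
  ◅◅ ≅⇒⇛ (Split.tail-around≅disjoint N')
  where open HeadAndTail X

facingAux : (A B : Set) → BaCell → Set
facingAux A B ctr = A
facingAux A B cctr = B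

facingLink : (A B : Set) → Port (A ⊎ B) BaCell (facingAux A B) → Port (A ⊎ B) BaCell (facingAux A B)
facingLink A B (free (inj₁ a)) = aux ctr a
facingLink A B (free (inj₂ b)) = aux cctr b
facingLink A B (prin ctr) = prin cctr
facingLink A B (prin cctr) = prin ctr
facingLink A B (aux ctr a) = free (inj₁ a)
facingLink A B (aux cctr b) = free (inj₂ b)

Facing : (A B : Set) → Net (A ⊎ B)
Facing A B = record { Cell = BaCell ; pol = baPol ; Aux = facingAux A B ; link = facingLink A B }

-- The reduct of Facing A B: a cocontraction (inj₁ a) at each leaf of the
-- contraction and a contraction (inj₂ b) at each leaf of the cocontraction,
-- every cocontraction joined to every contraction.
bipartitePol : {A B : Set} → A ⊎ B → Pol
bipartitePol (inj₁ _) = bang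
bipartitePol (inj₂ _) = qm

bipartiteAux : (A B : Set) → A ⊎ B → Set
bipartiteAux A B (inj₁ _) = B
bipartiteAux A B (inj₂ _) = A

bipartiteLink : (A B : Set) → Port (A ⊎ B) (A ⊎ B) (bipartiteAux A B) → Port (A ⊎ B) (A ⊎ B) (bipartiteAux A B)
bipartiteLink A B (free x) = prin x
bipartiteLink A B (prin x) = free x
bipartiteLink A B (aux (inj₁ a) b) = aux (inj₂ b) a
bipartiteLink A B (aux (inj₂ b) a) = aux (inj₁ a) b

Bipartite : (A B : Set) → Net (A ⊎ B)
Bipartite A B = record { Cell = A ⊎ B ; pol = bipartitePol ; Aux = bipartiteAux A B ; link = bipartiteLink A B }

Fin-suc↔ : {n : ℕ} → Fin (suc n) ↔ (⊤ ⊎ Fin n)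
Fin-suc↔ = mk↔ₛ′ (λ { zero → inj₁ tt ; (suc k) → inj₂ k }) (λ { (inj₁ tt) → zero ; (inj₂ k) → suc k })
          (λ { (inj₁ tt) → refl ; (inj₂ k) → refl }) (λ { zero → refl ; (suc k) → refl })

⊤⊎⊤↔Fin2 : (⊤ ⊎ ⊤) ↔ Fin 2
⊤⊎⊤↔Fin2 = mk↔ₛ′ (λ { (inj₁ tt) → zero ; (inj₂ tt) → suc zero }) (λ { zero → inj₁ tt ; (suc zero) → inj₂ tt })
       (λ { zero → refl ; (suc zero) → refl }) (λ { (inj₁ tt) → refl ; (inj₂ tt) → refl })

module CoweakeningBase where
  Labels : Set
  Labels = Fin 0 ⊎ Fin 0

  K-ε : Context Labels ⊥
  K-ε = record { CCell = ⊥ ; cpol = λ () ; CAux = λ () ; partner = partner ; holePartner = λ () }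
    where
    partner : Port Labels ⊥ (λ ()) → Port Labels ⊥ (λ ()) ⊎ ⊥
    partner (free (inj₁ ()))
    partner (free (inj₂ ()))

  to-ε-redex : Facing (Fin 0) (Fin 0) ≅ plug K-ε εL
  to-ε-redex = record
    { cellIso = mk↔ₛ′ (λ { ctr → inj₂ t ; cctr → inj₂ z }) (λ { (inj₂ t) → ctr ; (inj₂ z) → cctr })
                 (λ { (inj₂ t) → refl ; (inj₂ z) → refl }) (λ { ctr → refl ; cctr → refl })
    ; auxIso = λ { ctr → ↔-refl ; cctr → ↔-refl }
    ; polEq = λ { ctr → refl ; cctr → refl }
    ; linkEq = λ { (free (inj₁ ())) ; (free (inj₂ ())) ; (prin ctr) → refl ; (prin cctr) → refl
                 ; (aux ctr ()) ; (aux cctr ()) } }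

  from-ε-reduct : plug K-ε εR ≅ Bipartite (Fin 0) (Fin 0)
  from-ε-reduct = record
    { cellIso = mk↔ₛ′ (λ { (inj₂ ()) }) (λ { (inj₁ ()) ; (inj₂ ()) })
                 (λ { (inj₁ ()) ; (inj₂ ()) }) (λ { (inj₂ ()) })
    ; auxIso = λ { (inj₂ ()) }
    ; polEq = λ { (inj₂ ()) }
    ; linkEq = λ { (free (inj₁ ())) ; (free (inj₂ ())) ; (prin (inj₂ ())) ; (aux (inj₂ ()) _) } }

  reduce : Facing (Fin 0) (Fin 0) ⇛ Bipartite (Fin 0) (Fin 0)
  reduce = rule⇛ ε-rule K-ε to-ε-redex ◅◅ ≅⇒⇛ from-ε-reduct

module CoweakeningStep (n : ℕ) where
  Labels : Set
  Labels = Fin (suc n) ⊎ Fin 0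

  K-split : Context Labels (⊤ ⊎ (⊤ ⊎ Fin n))
  K-split = record { CCell = ⊤ ; cpol = λ _ → bang ; CAux = λ _ → Fin 0 ; partner = partner ; holePartner = hole }
    where
    partner : Port Labels ⊤ (λ _ → Fin 0) → Port Labels ⊤ (λ _ → Fin 0) ⊎ (⊤ ⊎ (⊤ ⊎ Fin n))
    partner (free (inj₁ zero)) = inj₂ (inj₂ (inj₁ tt))
    partner (free (inj₁ (suc k))) = inj₂ (inj₂ (inj₂ k))
    partner (free (inj₂ ()))
    partner (prin tt) = inj₂ (inj₁ tt)
    partner (aux tt ())
    hole : ⊤ ⊎ (⊤ ⊎ Fin n) → Port Labels ⊤ (λ _ → Fin 0)
    hole (inj₁ tt) = prin tt
    hole (inj₂ (inj₁ tt)) = free (inj₁ zero)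
    hole (inj₂ (inj₂ k)) = free (inj₁ (suc k))

  to-split : Facing (Fin (suc n)) (Fin 0) ≅ plug K-split (flatR qm ⊤ (Fin n))
  to-split = record
    { cellIso = mk↔ₛ′ (λ { ctr → inj₂ tt ; cctr → inj₁ tt }) (λ { (inj₂ tt) → ctr ; (inj₁ tt) → cctr })
                 (λ { (inj₂ tt) → refl ; (inj₁ tt) → refl }) (λ { ctr → refl ; cctr → refl })
    ; auxIso = λ { ctr → Fin-suc↔ ; cctr → ↔-refl }
    ; polEq = λ { ctr → refl ; cctr → refl }
    ; linkEq = λ { (free (inj₁ zero)) → refl ; (free (inj₁ (suc k))) → refl ; (free (inj₂ ()))
                 ; (prin ctr) → refl ; (prin cctr) → refl
                 ; (aux ctr zero) → refl ; (aux ctr (suc k)) → refl ; (aux cctr ()) } }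

  K-s : Context Labels (Fin 2)
  K-s = record { CCell = ⊤ ; cpol = λ _ → qm ; CAux = λ _ → Fin n ; partner = partner ; holePartner = hole }
    where
    partner : Port Labels ⊤ (λ _ → Fin n) → Port Labels ⊤ (λ _ → Fin n) ⊎ Fin 2
    partner (free (inj₁ zero)) = inj₂ zero
    partner (free (inj₁ (suc k))) = inj₁ (aux tt k)
    partner (free (inj₂ ()))
    partner (prin tt) = inj₂ (suc zero)
    partner (aux tt k) = inj₁ (free (inj₁ (suc k)))
    hole : Fin 2 → Port Labels ⊤ (λ _ → Fin n)
    hole zero = free (inj₁ zero)
    hole (suc zero) = prin tt

  to-s-redex : plug K-split (flatL qm ⊤ (Fin n)) ≅ plug K-s (sL bang)
  to-s-redex = record
    { cellIso = mk↔ₛ′ (λ { (inj₁ tt) → inj₂ z ; (inj₂ top) → inj₂ t ; (inj₂ sub) → inj₁ tt })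
                      (λ { (inj₂ z) → inj₁ tt ; (inj₂ t) → inj₂ top ; (inj₁ tt) → inj₂ sub })
                 (λ { (inj₂ z) → refl ; (inj₂ t) → refl ; (inj₁ tt) → refl })
                 (λ { (inj₁ tt) → refl ; (inj₂ top) → refl ; (inj₂ sub) → refl })
    ; auxIso = λ { (inj₁ tt) → ↔-refl ; (inj₂ top) → ⊤⊎⊤↔Fin2 ; (inj₂ sub) → ↔-refl }
    ; polEq = λ { (inj₁ tt) → refl ; (inj₂ top) → refl ; (inj₂ sub) → refl }
    ; linkEq = λ { (free (inj₁ zero)) → refl ; (free (inj₁ (suc k))) → refl ; (free (inj₂ ()))
                 ; (prin (inj₁ tt)) → refl ; (prin (inj₂ top)) → refl ; (prin (inj₂ sub)) → refl
                 ; (aux (inj₁ tt) ()) ; (aux (inj₂ top) (inj₁ tt)) → refl ; (aux (inj₂ top) (inj₂ tt)) → refl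
                 ; (aux (inj₂ sub) k) → refl } }

  K-rec : Context Labels (Fin n ⊎ Fin 0)
  K-rec = record { CCell = ⊤ ; cpol = λ _ → bang ; CAux = λ _ → Fin 0 ; partner = partner ; holePartner = hole }
    where
    partner : Port Labels ⊤ (λ _ → Fin 0) → Port Labels ⊤ (λ _ → Fin 0) ⊎ (Fin n ⊎ Fin 0)
    partner (free (inj₁ zero)) = inj₁ (prin tt)
    partner (free (inj₁ (suc k))) = inj₂ (inj₁ k)
    partner (free (inj₂ ()))
    partner (prin tt) = inj₁ (free (inj₁ zero))
    partner (aux tt ())
    hole : Fin n ⊎ Fin 0 → Port Labels ⊤ (λ _ → Fin 0)
    hole (inj₁ k) = free (inj₁ (suc k))
    hole (inj₂ ())

  to-rec : plug K-s (sR bang) ≅ plug K-rec (Facing (Fin n) (Fin 0))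
  to-rec = record
    { cellIso = mk↔ₛ′ (λ { (inj₁ tt) → inj₂ ctr ; (inj₂ zero) → inj₁ tt ; (inj₂ (suc zero)) → inj₂ cctr })
                      (λ { (inj₂ ctr) → inj₁ tt ; (inj₁ tt) → inj₂ zero ; (inj₂ cctr) → inj₂ (suc zero) })
                 (λ { (inj₂ ctr) → refl ; (inj₁ tt) → refl ; (inj₂ cctr) → refl })
                 (λ { (inj₁ tt) → refl ; (inj₂ zero) → refl ; (inj₂ (suc zero)) → refl })
    ; auxIso = λ { (inj₁ tt) → ↔-refl ; (inj₂ zero) → ↔-refl ; (inj₂ (suc zero)) → ↔-refl }
    ; polEq = λ { (inj₁ tt) → refl ; (inj₂ zero) → refl ; (inj₂ (suc zero)) → refl }
    ; linkEq = λ { (free (inj₁ zero)) → refl ; (free (inj₁ (suc k))) → refl ; (free (inj₂ ()))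
                 ; (prin (inj₁ tt)) → refl ; (prin (inj₂ zero)) → refl ; (prin (inj₂ (suc zero))) → refl
                 ; (aux (inj₁ tt) k) → refl ; (aux (inj₂ zero) ()) ; (aux (inj₂ (suc zero)) ()) } }

  from-rec : plug K-rec (Bipartite (Fin n) (Fin 0)) ≅ Bipartite (Fin (suc n)) (Fin 0)
  from-rec = record
    { cellIso = mk↔ₛ′ (λ { (inj₁ tt) → inj₁ zero ; (inj₂ (inj₁ k)) → inj₁ (suc k) ; (inj₂ (inj₂ ())) })
                      (λ { (inj₁ zero) → inj₁ tt ; (inj₁ (suc k)) → inj₂ (inj₁ k) ; (inj₂ ()) })
                 (λ { (inj₁ zero) → refl ; (inj₁ (suc k)) → refl ; (inj₂ ()) })
                 (λ { (inj₁ tt) → refl ; (inj₂ (inj₁ k)) → refl ; (inj₂ (inj₂ ())) })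
    ; auxIso = λ { (inj₁ tt) → ↔-refl ; (inj₂ (inj₁ k)) → ↔-refl ; (inj₂ (inj₂ ())) }
    ; polEq = λ { (inj₁ tt) → refl ; (inj₂ (inj₁ k)) → refl ; (inj₂ (inj₂ ())) }
    ; linkEq = λ { (free (inj₁ zero)) → refl ; (free (inj₁ (suc k))) → refl ; (free (inj₂ ()))
                 ; (prin (inj₁ tt)) → refl ; (prin (inj₂ (inj₁ k))) → refl ; (prin (inj₂ (inj₂ ())))
                 ; (aux (inj₁ tt) ()) ; (aux (inj₂ (inj₁ k)) ()) ; (aux (inj₂ (inj₂ ())) _) } }

-- Split the first leaf off the contraction; (s1) copies the coweakening onto both parts.
facing-coweakening⇛ : (n : ℕ) → Facing (Fin n) (Fin 0) ⇛ Bipartite (Fin n) (Fin 0)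
facing-coweakening⇛ zero = CoweakeningBase.reduce
facing-coweakening⇛ (suc n) =
  rule⇛ (unflatten-rule qm ⊤ (Fin n)) K-split to-split
  ◅◅ rule⇛ (s-rule bang) K-s to-s-redex
  ◅◅ ≅⇒⇛ to-rec
  ◅◅ plug-⇛ K-rec (facing-coweakening⇛ n)
  ◅◅ ≅⇒⇛ from-rec
  where open CoweakeningStep n

module BinaryBase where
  Labels : Set
  Labels = Fin 0 ⊎ Fin 2

  K-s : Context Labels (Fin 2)
  K-s = record { CCell = ⊥ ; cpol = λ () ; CAux = λ () ; partner = partner ; holePartner = λ k → free (inj₂ k) }
    where
    partner : Port Labels ⊥ (λ ()) → Port Labels ⊥ (λ ()) ⊎ Fin 2
    partner (free (inj₁ ()))
    partner (free (inj₂ k)) = inj₂ k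

  to-s-redex : Facing (Fin 0) (Fin 2) ≅ plug K-s (sL qm)
  to-s-redex = record
    { cellIso = mk↔ₛ′ (λ { ctr → inj₂ z ; cctr → inj₂ t }) (λ { (inj₂ z) → ctr ; (inj₂ t) → cctr })
                 (λ { (inj₂ z) → refl ; (inj₂ t) → refl }) (λ { ctr → refl ; cctr → refl })
    ; auxIso = λ { ctr → ↔-refl ; cctr → ↔-refl }
    ; polEq = λ { ctr → refl ; cctr → refl }
    ; linkEq = λ { (free (inj₁ ())) ; (free (inj₂ k)) → refl ; (prin ctr) → refl ; (prin cctr) → refl
                 ; (aux ctr ()) ; (aux cctr k) → refl } }

  from-s-reduct : plug K-s (sR qm) ≅ Bipartite (Fin 0) (Fin 2)
  from-s-reduct = record
    { cellIso = mk↔ₛ′ (λ { (inj₂ k) → inj₂ k }) (λ { (inj₁ ()) ; (inj₂ k) → inj₂ k })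
                 (λ { (inj₁ ()) ; (inj₂ k) → refl }) (λ { (inj₂ k) → refl })
    ; auxIso = λ { (inj₂ k) → ↔-refl }
    ; polEq = λ { (inj₂ k) → refl }
    ; linkEq = λ { (free (inj₁ ())) ; (free (inj₂ k)) → refl ; (prin (inj₂ k)) → refl ; (aux (inj₂ k) ()) } }

  reduce : Facing (Fin 0) (Fin 2) ⇛ Bipartite (Fin 0) (Fin 2)
  reduce = rule⇛ (s-rule qm) K-s to-s-redex ◅◅ ≅⇒⇛ from-s-reduct

module BinaryStep (n : ℕ) where
  Labels : Set
  Labels = Fin (suc n) ⊎ Fin 2

  K-split : Context Labels (⊤ ⊎ (⊤ ⊎ Fin n))
  K-split = record { CCell = ⊤ ; cpol = λ _ → bang ; CAux = λ _ → Fin 2 ; partner = partner ; holePartner = hole }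
    where
    partner : Port Labels ⊤ (λ _ → Fin 2) → Port Labels ⊤ (λ _ → Fin 2) ⊎ (⊤ ⊎ (⊤ ⊎ Fin n))
    partner (free (inj₁ zero)) = inj₂ (inj₂ (inj₁ tt))
    partner (free (inj₁ (suc k))) = inj₂ (inj₂ (inj₂ k))
    partner (free (inj₂ j)) = inj₁ (aux tt j)
    partner (prin tt) = inj₂ (inj₁ tt)
    partner (aux tt j) = inj₁ (free (inj₂ j))
    hole : ⊤ ⊎ (⊤ ⊎ Fin n) → Port Labels ⊤ (λ _ → Fin 2)
    hole (inj₁ tt) = prin tt
    hole (inj₂ (inj₁ tt)) = free (inj₁ zero)
    hole (inj₂ (inj₂ k)) = free (inj₁ (suc k))

  to-split : Facing (Fin (suc n)) (Fin 2) ≅ plug K-split (flatR qm ⊤ (Fin n))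
  to-split = record
    { cellIso = mk↔ₛ′ (λ { ctr → inj₂ tt ; cctr → inj₁ tt }) (λ { (inj₂ tt) → ctr ; (inj₁ tt) → cctr })
                 (λ { (inj₂ tt) → refl ; (inj₁ tt) → refl }) (λ { ctr → refl ; cctr → refl })
    ; auxIso = λ { ctr → Fin-suc↔ ; cctr → ↔-refl }
    ; polEq = λ { ctr → refl ; cctr → refl }
    ; linkEq = λ { (free (inj₁ zero)) → refl ; (free (inj₁ (suc k))) → refl ; (free (inj₂ j)) → refl
                 ; (prin ctr) → refl ; (prin cctr) → refl
                 ; (aux ctr zero) → refl ; (aux ctr (suc k)) → refl ; (aux cctr j) → refl } }

  K-ba : Context Labels (Fin 2 ⊎ Fin 2)
  K-ba = record { CCell = ⊤ ; cpol = λ _ → qm ; CAux = λ _ → Fin n ; partner = partner ; holePartner = hole }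
    where
    partner : Port Labels ⊤ (λ _ → Fin n) → Port Labels ⊤ (λ _ → Fin n) ⊎ (Fin 2 ⊎ Fin 2)
    partner (free (inj₁ zero)) = inj₂ (inj₁ zero)
    partner (free (inj₁ (suc k))) = inj₁ (aux tt k)
    partner (free (inj₂ j)) = inj₂ (inj₂ j)
    partner (prin tt) = inj₂ (inj₁ (suc zero))
    partner (aux tt k) = inj₁ (free (inj₁ (suc k)))
    hole : Fin 2 ⊎ Fin 2 → Port Labels ⊤ (λ _ → Fin n)
    hole (inj₁ zero) = free (inj₁ zero)
    hole (inj₁ (suc zero)) = prin tt
    hole (inj₂ j) = free (inj₂ j)

  to-ba-redex : plug K-split (flatL qm ⊤ (Fin n)) ≅ plug K-ba baL
  to-ba-redex = record
    { cellIso = mk↔ₛ′ (λ { (inj₁ tt) → inj₂ cctr ; (inj₂ top) → inj₂ ctr ; (inj₂ sub) → inj₁ tt })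
                      (λ { (inj₂ cctr) → inj₁ tt ; (inj₂ ctr) → inj₂ top ; (inj₁ tt) → inj₂ sub })
                 (λ { (inj₂ cctr) → refl ; (inj₂ ctr) → refl ; (inj₁ tt) → refl })
                 (λ { (inj₁ tt) → refl ; (inj₂ top) → refl ; (inj₂ sub) → refl })
    ; auxIso = λ { (inj₁ tt) → ↔-refl ; (inj₂ top) → ⊤⊎⊤↔Fin2 ; (inj₂ sub) → ↔-refl }
    ; polEq = λ { (inj₁ tt) → refl ; (inj₂ top) → refl ; (inj₂ sub) → refl }
    ; linkEq = λ { (free (inj₁ zero)) → refl ; (free (inj₁ (suc k))) → refl ; (free (inj₂ j)) → refl
                 ; (prin (inj₁ tt)) → refl ; (prin (inj₂ top)) → refl ; (prin (inj₂ sub)) → refl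
                 ; (aux (inj₁ tt) j) → refl ; (aux (inj₂ top) (inj₁ tt)) → refl ; (aux (inj₂ top) (inj₂ tt)) → refl
                 ; (aux (inj₂ sub) k) → refl } }

  recAux : ⊤ ⊎ Fin 2 → Set
  recAux _ = Fin 2

  recPol : ⊤ ⊎ Fin 2 → Pol
  recPol (inj₁ _) = bang
  recPol (inj₂ _) = qm

  K-rec : Context Labels (Fin n ⊎ Fin 2)
  K-rec = record { CCell = ⊤ ⊎ Fin 2 ; cpol = recPol ; CAux = recAux ; partner = partner ; holePartner = hole }
    where
    partner : Port Labels (⊤ ⊎ Fin 2) recAux → Port Labels (⊤ ⊎ Fin 2) recAux ⊎ (Fin n ⊎ Fin 2)
    partner (free (inj₁ zero)) = inj₁ (prin (inj₁ tt))
    partner (free (inj₁ (suc k))) = inj₂ (inj₁ k)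
    partner (free (inj₂ j)) = inj₁ (prin (inj₂ j))
    partner (prin (inj₁ tt)) = inj₁ (free (inj₁ zero))
    partner (aux (inj₁ tt) j) = inj₁ (aux (inj₂ j) zero)
    partner (prin (inj₂ j)) = inj₁ (free (inj₂ j))
    partner (aux (inj₂ j) zero) = inj₁ (aux (inj₁ tt) j)
    partner (aux (inj₂ j) (suc zero)) = inj₂ (inj₂ j)
    hole : Fin n ⊎ Fin 2 → Port Labels (⊤ ⊎ Fin 2) recAux
    hole (inj₁ k) = free (inj₁ (suc k))
    hole (inj₂ j) = aux (inj₂ j) (suc zero)

  to-rec : plug K-ba baR ≅ plug K-rec (Facing (Fin n) (Fin 2))
  to-rec = record
    { cellIso = mk↔ₛ′ (λ { (inj₁ tt) → inj₂ ctr ; (inj₂ (inj₁ zero)) → inj₁ (inj₁ tt)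
                         ; (inj₂ (inj₁ (suc zero))) → inj₂ cctr ; (inj₂ (inj₂ j)) → inj₁ (inj₂ j) })
                      (λ { (inj₂ ctr) → inj₁ tt ; (inj₁ (inj₁ tt)) → inj₂ (inj₁ zero)
                         ; (inj₂ cctr) → inj₂ (inj₁ (suc zero)) ; (inj₁ (inj₂ j)) → inj₂ (inj₂ j) })
                 (λ { (inj₂ ctr) → refl ; (inj₁ (inj₁ tt)) → refl ; (inj₂ cctr) → refl ; (inj₁ (inj₂ j)) → refl })
                 (λ { (inj₁ tt) → refl ; (inj₂ (inj₁ zero)) → refl ; (inj₂ (inj₁ (suc zero))) → refl ; (inj₂ (inj₂ j)) → refl })
    ; auxIso = λ { (inj₁ tt) → ↔-refl ; (inj₂ (inj₁ zero)) → ↔-refl ; (inj₂ (inj₁ (suc zero))) → ↔-refl ; (inj₂ (inj₂ j)) → ↔-refl }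
    ; polEq = λ { (inj₁ tt) → refl ; (inj₂ (inj₁ zero)) → refl ; (inj₂ (inj₁ (suc zero))) → refl ; (inj₂ (inj₂ j)) → refl }
    ; linkEq = λ { (free (inj₁ zero)) → refl ; (free (inj₁ (suc k))) → refl ; (free (inj₂ j)) → refl
                 ; (prin (inj₁ tt)) → refl ; (prin (inj₂ (inj₁ zero))) → refl ; (prin (inj₂ (inj₁ (suc zero)))) → refl
                 ; (prin (inj₂ (inj₂ j))) → refl
                 ; (aux (inj₁ tt) k) → refl
                 ; (aux (inj₂ (inj₁ zero)) zero) → refl ; (aux (inj₂ (inj₁ zero)) (suc zero)) → refl
                 ; (aux (inj₂ (inj₁ (suc zero))) zero) → refl ; (aux (inj₂ (inj₁ (suc zero))) (suc zero)) → refl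
                 ; (aux (inj₂ (inj₂ j)) zero) → refl ; (aux (inj₂ (inj₂ j)) (suc zero)) → refl } }

  data Merge₁Cell : Set where
    coc-zero ctr-top ctr-sub : Merge₁Cell
    coc-suc : Fin n → Merge₁Cell

  merge₁Aux : Merge₁Cell → Set
  merge₁Aux ctr-sub = Fin n
  merge₁Aux _ = Fin 2

  merge₁Pol : Merge₁Cell → Pol
  merge₁Pol coc-zero = bang
  merge₁Pol ctr-top = qm
  merge₁Pol ctr-sub = qm
  merge₁Pol (coc-suc _) = bang

  K-merge₁ : Context Labels (⊤ ⊎ (⊤ ⊎ Fin n))
  K-merge₁ = record { CCell = Merge₁Cell ; cpol = merge₁Pol ; CAux = merge₁Aux ; partner = partner ; holePartner = hole }
    where
    partner : Port Labels Merge₁Cell merge₁Aux → Port Labels Merge₁Cell merge₁Aux ⊎ (⊤ ⊎ (⊤ ⊎ Fin n))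
    partner (free (inj₁ zero)) = inj₁ (prin coc-zero)
    partner (free (inj₁ (suc k))) = inj₁ (prin (coc-suc k))
    partner (free (inj₂ zero)) = inj₂ (inj₁ tt)
    partner (free (inj₂ (suc zero))) = inj₁ (prin ctr-top)
    partner (prin coc-zero) = inj₁ (free (inj₁ zero))
    partner (aux coc-zero zero) = inj₂ (inj₂ (inj₁ tt))
    partner (aux coc-zero (suc zero)) = inj₁ (aux ctr-top zero)
    partner (prin ctr-top) = inj₁ (free (inj₂ (suc zero)))
    partner (aux ctr-top zero) = inj₁ (aux coc-zero (suc zero))
    partner (aux ctr-top (suc zero)) = inj₁ (prin ctr-sub)
    partner (prin (coc-suc k)) = inj₁ (free (inj₁ (suc k)))
    partner (aux (coc-suc k) zero) = inj₂ (inj₂ (inj₂ k))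
    partner (aux (coc-suc k) (suc zero)) = inj₁ (aux ctr-sub k)
    partner (prin ctr-sub) = inj₁ (aux ctr-top (suc zero))
    partner (aux ctr-sub k) = inj₁ (aux (coc-suc k) (suc zero))
    hole : ⊤ ⊎ (⊤ ⊎ Fin n) → Port Labels Merge₁Cell merge₁Aux
    hole (inj₁ tt) = free (inj₂ zero)
    hole (inj₂ (inj₁ tt)) = aux coc-zero zero
    hole (inj₂ (inj₂ k)) = aux (coc-suc k) zero

  to-merge₁ : plug K-rec (Bipartite (Fin n) (Fin 2)) ≅ plug K-merge₁ (flatL qm ⊤ (Fin n))
  to-merge₁ = record
    { cellIso = mk↔ₛ′ (λ { (inj₁ (inj₁ tt)) → inj₁ coc-zero ; (inj₁ (inj₂ zero)) → inj₂ top
                         ; (inj₁ (inj₂ (suc zero))) → inj₁ ctr-top ; (inj₂ (inj₁ k)) → inj₁ (coc-suc k)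
                         ; (inj₂ (inj₂ zero)) → inj₂ sub ; (inj₂ (inj₂ (suc zero))) → inj₁ ctr-sub })
                      (λ { (inj₁ coc-zero) → inj₁ (inj₁ tt) ; (inj₂ top) → inj₁ (inj₂ zero)
                         ; (inj₁ ctr-top) → inj₁ (inj₂ (suc zero)) ; (inj₁ (coc-suc k)) → inj₂ (inj₁ k)
                         ; (inj₂ sub) → inj₂ (inj₂ zero) ; (inj₁ ctr-sub) → inj₂ (inj₂ (suc zero)) })
                 (λ { (inj₁ coc-zero) → refl ; (inj₂ top) → refl ; (inj₁ ctr-top) → refl ; (inj₁ (coc-suc k)) → refl
                    ; (inj₂ sub) → refl ; (inj₁ ctr-sub) → refl })
                 (λ { (inj₁ (inj₁ tt)) → refl ; (inj₁ (inj₂ zero)) → refl ; (inj₁ (inj₂ (suc zero))) → refl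
                    ; (inj₂ (inj₁ k)) → refl ; (inj₂ (inj₂ zero)) → refl ; (inj₂ (inj₂ (suc zero))) → refl })
    ; auxIso = λ { (inj₁ (inj₁ tt)) → ↔-refl ; (inj₁ (inj₂ zero)) → ↔-sym ⊤⊎⊤↔Fin2 ; (inj₁ (inj₂ (suc zero))) → ↔-refl
                 ; (inj₂ (inj₁ k)) → ↔-refl ; (inj₂ (inj₂ zero)) → ↔-refl ; (inj₂ (inj₂ (suc zero))) → ↔-refl }
    ; polEq = λ { (inj₁ (inj₁ tt)) → refl ; (inj₁ (inj₂ zero)) → refl ; (inj₁ (inj₂ (suc zero))) → refl
                 ; (inj₂ (inj₁ k)) → refl ; (inj₂ (inj₂ zero)) → refl ; (inj₂ (inj₂ (suc zero))) → refl }
    ; linkEq = λ { (free (inj₁ zero)) → refl ; (free (inj₁ (suc k))) → refl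
                 ; (free (inj₂ zero)) → refl ; (free (inj₂ (suc zero))) → refl
                 ; (prin (inj₁ (inj₁ tt))) → refl ; (aux (inj₁ (inj₁ tt)) zero) → refl ; (aux (inj₁ (inj₁ tt)) (suc zero)) → refl
                 ; (prin (inj₁ (inj₂ zero))) → refl ; (aux (inj₁ (inj₂ zero)) zero) → refl ; (aux (inj₁ (inj₂ zero)) (suc zero)) → refl
                 ; (prin (inj₁ (inj₂ (suc zero)))) → refl ; (aux (inj₁ (inj₂ (suc zero))) zero) → refl
                 ; (aux (inj₁ (inj₂ (suc zero))) (suc zero)) → refl
                 ; (prin (inj₂ (inj₁ k))) → refl ; (aux (inj₂ (inj₁ k)) zero) → refl ; (aux (inj₂ (inj₁ k)) (suc zero)) → refl
                 ; (prin (inj₂ (inj₂ zero))) → refl ; (aux (inj₂ (inj₂ zero)) k) → refl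
                 ; (prin (inj₂ (inj₂ (suc zero)))) → refl ; (aux (inj₂ (inj₂ (suc zero))) k) → refl } }

  data Merge₂Cell : Set where
    coc-zero ctr-merged : Merge₂Cell
    coc-suc : Fin n → Merge₂Cell

  merge₂Aux : Merge₂Cell → Set
  merge₂Aux ctr-merged = ⊤ ⊎ Fin n
  merge₂Aux _ = Fin 2

  merge₂Pol : Merge₂Cell → Pol
  merge₂Pol coc-zero = bang
  merge₂Pol ctr-merged = qm
  merge₂Pol (coc-suc _) = bang

  K-merge₂ : Context Labels (⊤ ⊎ (⊤ ⊎ Fin n))
  K-merge₂ = record { CCell = Merge₂Cell ; cpol = merge₂Pol ; CAux = merge₂Aux ; partner = partner ; holePartner = hole }
    where
    partner : Port Labels Merge₂Cell merge₂Aux → Port Labels Merge₂Cell merge₂Aux ⊎ (⊤ ⊎ (⊤ ⊎ Fin n))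
    partner (free (inj₁ zero)) = inj₁ (prin coc-zero)
    partner (free (inj₁ (suc k))) = inj₁ (prin (coc-suc k))
    partner (free (inj₂ zero)) = inj₁ (prin ctr-merged)
    partner (free (inj₂ (suc zero))) = inj₂ (inj₁ tt)
    partner (prin coc-zero) = inj₁ (free (inj₁ zero))
    partner (aux coc-zero zero) = inj₁ (aux ctr-merged (inj₁ tt))
    partner (aux coc-zero (suc zero)) = inj₂ (inj₂ (inj₁ tt))
    partner (prin ctr-merged) = inj₁ (free (inj₂ zero))
    partner (aux ctr-merged (inj₁ tt)) = inj₁ (aux coc-zero zero)
    partner (aux ctr-merged (inj₂ k)) = inj₁ (aux (coc-suc k) zero)
    partner (prin (coc-suc k)) = inj₁ (free (inj₁ (suc k)))
    partner (aux (coc-suc k) zero) = inj₁ (aux ctr-merged (inj₂ k))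
    partner (aux (coc-suc k) (suc zero)) = inj₂ (inj₂ (inj₂ k))
    hole : ⊤ ⊎ (⊤ ⊎ Fin n) → Port Labels Merge₂Cell merge₂Aux
    hole (inj₁ tt) = free (inj₂ (suc zero))
    hole (inj₂ (inj₁ tt)) = aux coc-zero (suc zero)
    hole (inj₂ (inj₂ k)) = aux (coc-suc k) (suc zero)

  to-merge₂ : plug K-merge₁ (flatR qm ⊤ (Fin n)) ≅ plug K-merge₂ (flatL qm ⊤ (Fin n))
  to-merge₂ = record
    { cellIso = mk↔ₛ′ (λ { (inj₁ coc-zero) → inj₁ coc-zero ; (inj₁ ctr-top) → inj₂ top ; (inj₁ (coc-suc k)) → inj₁ (coc-suc k)
                         ; (inj₁ ctr-sub) → inj₂ sub ; (inj₂ tt) → inj₁ ctr-merged })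
                      (λ { (inj₁ coc-zero) → inj₁ coc-zero ; (inj₂ top) → inj₁ ctr-top ; (inj₁ (coc-suc k)) → inj₁ (coc-suc k)
                         ; (inj₂ sub) → inj₁ ctr-sub ; (inj₁ ctr-merged) → inj₂ tt })
                 (λ { (inj₁ coc-zero) → refl ; (inj₂ top) → refl ; (inj₁ (coc-suc k)) → refl ; (inj₂ sub) → refl ; (inj₁ ctr-merged) → refl })
                 (λ { (inj₁ coc-zero) → refl ; (inj₁ ctr-top) → refl ; (inj₁ (coc-suc k)) → refl ; (inj₁ ctr-sub) → refl ; (inj₂ tt) → refl })
    ; auxIso = λ { (inj₁ coc-zero) → ↔-refl ; (inj₁ ctr-top) → ↔-sym ⊤⊎⊤↔Fin2 ; (inj₁ (coc-suc k)) → ↔-refl ; (inj₁ ctr-sub) → ↔-refl ; (inj₂ tt) → ↔-refl }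
    ; polEq = λ { (inj₁ coc-zero) → refl ; (inj₁ ctr-top) → refl ; (inj₁ (coc-suc k)) → refl ; (inj₁ ctr-sub) → refl ; (inj₂ tt) → refl }
    ; linkEq = λ { (free (inj₁ zero)) → refl ; (free (inj₁ (suc k))) → refl
                 ; (free (inj₂ zero)) → refl ; (free (inj₂ (suc zero))) → refl
                 ; (prin (inj₁ coc-zero)) → refl ; (aux (inj₁ coc-zero) zero) → refl ; (aux (inj₁ coc-zero) (suc zero)) → refl
                 ; (prin (inj₁ ctr-top)) → refl ; (aux (inj₁ ctr-top) zero) → refl ; (aux (inj₁ ctr-top) (suc zero)) → refl
                 ; (prin (inj₁ (coc-suc k))) → refl ; (aux (inj₁ (coc-suc k)) zero) → refl ; (aux (inj₁ (coc-suc k)) (suc zero)) → refl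
                 ; (prin (inj₁ ctr-sub)) → refl ; (aux (inj₁ ctr-sub) k) → refl
                 ; (prin (inj₂ tt)) → refl ; (aux (inj₂ tt) (inj₁ tt)) → refl ; (aux (inj₂ tt) (inj₂ k)) → refl } }

  from-merge₂ : plug K-merge₂ (flatR qm ⊤ (Fin n)) ≅ Bipartite (Fin (suc n)) (Fin 2)
  from-merge₂ = record
    { cellIso = mk↔ₛ′ (λ { (inj₁ coc-zero) → inj₁ zero ; (inj₁ (coc-suc k)) → inj₁ (suc k) ; (inj₁ ctr-merged) → inj₂ zero
                         ; (inj₂ tt) → inj₂ (suc zero) })
                      (λ { (inj₁ zero) → inj₁ coc-zero ; (inj₁ (suc k)) → inj₁ (coc-suc k) ; (inj₂ zero) → inj₁ ctr-merged
                         ; (inj₂ (suc zero)) → inj₂ tt })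
                 (λ { (inj₁ zero) → refl ; (inj₁ (suc k)) → refl ; (inj₂ zero) → refl ; (inj₂ (suc zero)) → refl })
                 (λ { (inj₁ coc-zero) → refl ; (inj₁ (coc-suc k)) → refl ; (inj₁ ctr-merged) → refl ; (inj₂ tt) → refl })
    ; auxIso = λ { (inj₁ coc-zero) → ↔-refl ; (inj₁ (coc-suc k)) → ↔-refl ; (inj₁ ctr-merged) → ↔-sym Fin-suc↔ ; (inj₂ tt) → ↔-sym Fin-suc↔ }
    ; polEq = λ { (inj₁ coc-zero) → refl ; (inj₁ (coc-suc k)) → refl ; (inj₁ ctr-merged) → refl ; (inj₂ tt) → refl }
    ; linkEq = λ { (free (inj₁ zero)) → refl ; (free (inj₁ (suc k))) → refl
                 ; (free (inj₂ zero)) → refl ; (free (inj₂ (suc zero))) → refl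
                 ; (prin (inj₁ coc-zero)) → refl ; (aux (inj₁ coc-zero) zero) → refl ; (aux (inj₁ coc-zero) (suc zero)) → refl
                 ; (prin (inj₁ (coc-suc k))) → refl ; (aux (inj₁ (coc-suc k)) zero) → refl ; (aux (inj₁ (coc-suc k)) (suc zero)) → refl
                 ; (prin (inj₁ ctr-merged)) → refl ; (aux (inj₁ ctr-merged) (inj₁ tt)) → refl ; (aux (inj₁ ctr-merged) (inj₂ k)) → refl
                 ; (prin (inj₂ tt)) → refl ; (aux (inj₂ tt) (inj₁ tt)) → refl ; (aux (inj₂ tt) (inj₂ k)) → refl } }

-- Split the first leaf off the contraction, fire (ba), recurse on the rest of the
-- contraction, and merge the two contractions created at each cocontraction leaf.
facing-binary⇛ : (n : ℕ) → Facing (Fin n) (Fin 2) ⇛ Bipartite (Fin n) (Fin 2)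
facing-binary⇛ zero = BinaryBase.reduce
facing-binary⇛ (suc n) =
  rule⇛ (unflatten-rule qm ⊤ (Fin n)) K-split to-split
  ◅◅ rule⇛ ba-rule K-ba to-ba-redex
  ◅◅ ≅⇒⇛ to-rec
  ◅◅ plug-⇛ K-rec (facing-binary⇛ n)
  ◅◅ rule⇛ (flatten-rule qm ⊤ (Fin n)) K-merge₁ to-merge₁
  ◅◅ rule⇛ (flatten-rule qm ⊤ (Fin n)) K-merge₂ to-merge₂
  ◅◅ ≅⇒⇛ from-merge₂
  where open BinaryStep n

module GeneralStep (n m : ℕ) where
  Labels : Set
  Labels = Fin n ⊎ Fin (suc m)

  K-split : Context Labels (⊤ ⊎ (⊤ ⊎ Fin m))
  K-split = record { CCell = ⊤ ; cpol = λ _ → qm ; CAux = λ _ → Fin n ; partner = partner ; holePartner = hole }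
    where
    partner : Port Labels ⊤ (λ _ → Fin n) → Port Labels ⊤ (λ _ → Fin n) ⊎ (⊤ ⊎ (⊤ ⊎ Fin m))
    partner (free (inj₁ a)) = inj₁ (aux tt a)
    partner (free (inj₂ zero)) = inj₂ (inj₂ (inj₁ tt))
    partner (free (inj₂ (suc b))) = inj₂ (inj₂ (inj₂ b))
    partner (prin tt) = inj₂ (inj₁ tt)
    partner (aux tt a) = inj₁ (free (inj₁ a))
    hole : ⊤ ⊎ (⊤ ⊎ Fin m) → Port Labels ⊤ (λ _ → Fin n)
    hole (inj₁ tt) = prin tt
    hole (inj₂ (inj₁ tt)) = free (inj₂ zero)
    hole (inj₂ (inj₂ b)) = free (inj₂ (suc b))

  to-split : Facing (Fin n) (Fin (suc m)) ≅ plug K-split (flatR bang ⊤ (Fin m))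
  to-split = record
    { cellIso = mk↔ₛ′ (λ { ctr → inj₁ tt ; cctr → inj₂ tt }) (λ { (inj₁ tt) → ctr ; (inj₂ tt) → cctr })
                 (λ { (inj₁ tt) → refl ; (inj₂ tt) → refl }) (λ { ctr → refl ; cctr → refl })
    ; auxIso = λ { ctr → ↔-refl ; cctr → Fin-suc↔ }
    ; polEq = λ { ctr → refl ; cctr → refl }
    ; linkEq = λ { (free (inj₁ a)) → refl ; (free (inj₂ zero)) → refl ; (free (inj₂ (suc b))) → refl
                 ; (prin ctr) → refl ; (prin cctr) → refl
                 ; (aux ctr a) → refl ; (aux cctr zero) → refl ; (aux cctr (suc b)) → refl } }

  K-binary : Context Labels (Fin n ⊎ Fin 2)
  K-binary = record { CCell = ⊤ ; cpol = λ _ → bang ; CAux = λ _ → Fin m ; partner = partner ; holePartner = hole }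
    where
    partner : Port Labels ⊤ (λ _ → Fin m) → Port Labels ⊤ (λ _ → Fin m) ⊎ (Fin n ⊎ Fin 2)
    partner (free (inj₁ a)) = inj₂ (inj₁ a)
    partner (free (inj₂ zero)) = inj₂ (inj₂ zero)
    partner (free (inj₂ (suc b))) = inj₁ (aux tt b)
    partner (prin tt) = inj₂ (inj₂ (suc zero))
    partner (aux tt b) = inj₁ (free (inj₂ (suc b)))
    hole : Fin n ⊎ Fin 2 → Port Labels ⊤ (λ _ → Fin m)
    hole (inj₁ a) = free (inj₁ a)
    hole (inj₂ zero) = free (inj₂ zero)
    hole (inj₂ (suc zero)) = prin tt

  to-binary : plug K-split (flatL bang ⊤ (Fin m)) ≅ plug K-binary (Facing (Fin n) (Fin 2))
  to-binary = record
    { cellIso = mk↔ₛ′ (λ { (inj₁ tt) → inj₂ ctr ; (inj₂ top) → inj₂ cctr ; (inj₂ sub) → inj₁ tt })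
                      (λ { (inj₂ ctr) → inj₁ tt ; (inj₂ cctr) → inj₂ top ; (inj₁ tt) → inj₂ sub })
                 (λ { (inj₂ ctr) → refl ; (inj₂ cctr) → refl ; (inj₁ tt) → refl })
                 (λ { (inj₁ tt) → refl ; (inj₂ top) → refl ; (inj₂ sub) → refl })
    ; auxIso = λ { (inj₁ tt) → ↔-refl ; (inj₂ top) → ⊤⊎⊤↔Fin2 ; (inj₂ sub) → ↔-refl }
    ; polEq = λ { (inj₁ tt) → refl ; (inj₂ top) → refl ; (inj₂ sub) → refl }
    ; linkEq = λ { (free (inj₁ a)) → refl ; (free (inj₂ zero)) → refl ; (free (inj₂ (suc b))) → refl
                 ; (prin (inj₁ tt)) → refl ; (prin (inj₂ top)) → refl ; (prin (inj₂ sub)) → refl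
                 ; (aux (inj₁ tt) a) → refl ; (aux (inj₂ top) (inj₁ tt)) → refl ; (aux (inj₂ top) (inj₂ tt)) → refl
                 ; (aux (inj₂ sub) b) → refl } }

  recAux : Fin n ⊎ ⊤ → Set
  recAux (inj₁ _) = Fin 2
  recAux (inj₂ _) = Fin n

  recPol : Fin n ⊎ ⊤ → Pol
  recPol (inj₁ _) = bang
  recPol (inj₂ _) = qm

  K-rec : Context Labels (Fin n ⊎ Fin m)
  K-rec = record { CCell = Fin n ⊎ ⊤ ; cpol = recPol ; CAux = recAux ; partner = partner ; holePartner = hole }
    where
    partner : Port Labels (Fin n ⊎ ⊤) recAux → Port Labels (Fin n ⊎ ⊤) recAux ⊎ (Fin n ⊎ Fin m)
    partner (free (inj₁ a)) = inj₁ (prin (inj₁ a))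
    partner (free (inj₂ zero)) = inj₁ (prin (inj₂ tt))
    partner (free (inj₂ (suc b))) = inj₂ (inj₂ b)
    partner (prin (inj₁ a)) = inj₁ (free (inj₁ a))
    partner (aux (inj₁ a) zero) = inj₁ (aux (inj₂ tt) a)
    partner (aux (inj₁ a) (suc zero)) = inj₂ (inj₁ a)
    partner (prin (inj₂ tt)) = inj₁ (free (inj₂ zero))
    partner (aux (inj₂ tt) a) = inj₁ (aux (inj₁ a) zero)
    hole : Fin n ⊎ Fin m → Port Labels (Fin n ⊎ ⊤) recAux
    hole (inj₁ a) = aux (inj₁ a) (suc zero)
    hole (inj₂ b) = free (inj₂ (suc b))

  to-rec : plug K-binary (Bipartite (Fin n) (Fin 2)) ≅ plug K-rec (Facing (Fin n) (Fin m))
  to-rec = record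
    { cellIso = mk↔ₛ′ (λ { (inj₁ tt) → inj₂ cctr ; (inj₂ (inj₁ a)) → inj₁ (inj₁ a)
                         ; (inj₂ (inj₂ zero)) → inj₁ (inj₂ tt) ; (inj₂ (inj₂ (suc zero))) → inj₂ ctr })
                      (λ { (inj₂ cctr) → inj₁ tt ; (inj₁ (inj₁ a)) → inj₂ (inj₁ a)
                         ; (inj₁ (inj₂ tt)) → inj₂ (inj₂ zero) ; (inj₂ ctr) → inj₂ (inj₂ (suc zero)) })
                 (λ { (inj₂ cctr) → refl ; (inj₁ (inj₁ a)) → refl ; (inj₁ (inj₂ tt)) → refl ; (inj₂ ctr) → refl })
                 (λ { (inj₁ tt) → refl ; (inj₂ (inj₁ a)) → refl ; (inj₂ (inj₂ zero)) → refl ; (inj₂ (inj₂ (suc zero))) → refl })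
    ; auxIso = λ { (inj₁ tt) → ↔-refl ; (inj₂ (inj₁ a)) → ↔-refl ; (inj₂ (inj₂ zero)) → ↔-refl ; (inj₂ (inj₂ (suc zero))) → ↔-refl }
    ; polEq = λ { (inj₁ tt) → refl ; (inj₂ (inj₁ a)) → refl ; (inj₂ (inj₂ zero)) → refl ; (inj₂ (inj₂ (suc zero))) → refl }
    ; linkEq = λ { (free (inj₁ a)) → refl ; (free (inj₂ zero)) → refl ; (free (inj₂ (suc b))) → refl
                 ; (prin (inj₁ tt)) → refl ; (aux (inj₁ tt) b) → refl
                 ; (prin (inj₂ (inj₁ a))) → refl ; (aux (inj₂ (inj₁ a)) zero) → refl ; (aux (inj₂ (inj₁ a)) (suc zero)) → refl
                 ; (prin (inj₂ (inj₂ zero))) → refl ; (aux (inj₂ (inj₂ zero)) a) → refl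
                 ; (prin (inj₂ (inj₂ (suc zero)))) → refl ; (aux (inj₂ (inj₂ (suc zero))) a) → refl } }

  Leaves : Fin n → Set
  Leaves _ = ⊤ ⊎ (⊤ ⊎ Fin m)

  K-merge : Context Labels (Σ (Fin n) Leaves)
  K-merge = record { CCell = ⊤ ⊎ Fin m ; cpol = λ _ → qm ; CAux = λ _ → Fin n ; partner = partner ; holePartner = hole }
    where
    partner : Port Labels (⊤ ⊎ Fin m) (λ _ → Fin n) → Port Labels (⊤ ⊎ Fin m) (λ _ → Fin n) ⊎ Σ (Fin n) Leaves
    partner (free (inj₁ a)) = inj₂ (a , inj₁ tt)
    partner (free (inj₂ zero)) = inj₁ (prin (inj₁ tt))
    partner (free (inj₂ (suc b))) = inj₁ (prin (inj₂ b))
    partner (prin (inj₁ tt)) = inj₁ (free (inj₂ zero))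
    partner (aux (inj₁ tt) a) = inj₂ (a , inj₂ (inj₁ tt))
    partner (prin (inj₂ b)) = inj₁ (free (inj₂ (suc b)))
    partner (aux (inj₂ b) a) = inj₂ (a , inj₂ (inj₂ b))
    hole : Σ (Fin n) Leaves → Port Labels (⊤ ⊎ Fin m) (λ _ → Fin n)
    hole (a , inj₁ tt) = free (inj₁ a)
    hole (a , inj₂ (inj₁ tt)) = aux (inj₁ tt) a
    hole (a , inj₂ (inj₂ b)) = aux (inj₂ b) a

  to-merge : plug K-rec (Bipartite (Fin n) (Fin m)) ≅ plug K-merge (Disjoint Leaves (λ _ → flatL bang ⊤ (Fin m)))
  to-merge = record
    { cellIso = mk↔ₛ′ (λ { (inj₁ (inj₁ a)) → inj₂ (a , top) ; (inj₁ (inj₂ tt)) → inj₁ (inj₁ tt)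
                         ; (inj₂ (inj₁ a)) → inj₂ (a , sub) ; (inj₂ (inj₂ b)) → inj₁ (inj₂ b) })
                      (λ { (inj₂ (a , top)) → inj₁ (inj₁ a) ; (inj₁ (inj₁ tt)) → inj₁ (inj₂ tt)
                         ; (inj₂ (a , sub)) → inj₂ (inj₁ a) ; (inj₁ (inj₂ b)) → inj₂ (inj₂ b) })
                 (λ { (inj₂ (a , top)) → refl ; (inj₁ (inj₁ tt)) → refl ; (inj₂ (a , sub)) → refl ; (inj₁ (inj₂ b)) → refl })
                 (λ { (inj₁ (inj₁ a)) → refl ; (inj₁ (inj₂ tt)) → refl ; (inj₂ (inj₁ a)) → refl ; (inj₂ (inj₂ b)) → refl })
    ; auxIso = λ { (inj₁ (inj₁ a)) → ↔-sym ⊤⊎⊤↔Fin2 ; (inj₁ (inj₂ tt)) → ↔-refl ; (inj₂ (inj₁ a)) → ↔-refl ; (inj₂ (inj₂ b)) → ↔-refl }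
    ; polEq = λ { (inj₁ (inj₁ a)) → refl ; (inj₁ (inj₂ tt)) → refl ; (inj₂ (inj₁ a)) → refl ; (inj₂ (inj₂ b)) → refl }
    ; linkEq = λ { (free (inj₁ a)) → refl ; (free (inj₂ zero)) → refl ; (free (inj₂ (suc b))) → refl
                 ; (prin (inj₁ (inj₁ a))) → refl ; (aux (inj₁ (inj₁ a)) zero) → refl ; (aux (inj₁ (inj₁ a)) (suc zero)) → refl
                 ; (prin (inj₁ (inj₂ tt))) → refl ; (aux (inj₁ (inj₂ tt)) a) → refl
                 ; (prin (inj₂ (inj₁ a))) → refl ; (aux (inj₂ (inj₁ a)) b) → refl
                 ; (prin (inj₂ (inj₂ b))) → refl ; (aux (inj₂ (inj₂ b)) a) → refl } }

  from-merge : plug K-merge (Disjoint Leaves (λ _ → plug idᶜ (flatR bang ⊤ (Fin m)))) ≅ Bipartite (Fin n) (Fin (suc m))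
  from-merge = record
    { cellIso = mk↔ₛ′ (λ { (inj₁ (inj₁ tt)) → inj₂ zero ; (inj₁ (inj₂ b)) → inj₂ (suc b)
                         ; (inj₂ (a , inj₂ tt)) → inj₁ a ; (inj₂ (a , inj₁ ())) })
                      (λ { (inj₂ zero) → inj₁ (inj₁ tt) ; (inj₂ (suc b)) → inj₁ (inj₂ b) ; (inj₁ a) → inj₂ (a , inj₂ tt) })
                 (λ { (inj₂ zero) → refl ; (inj₂ (suc b)) → refl ; (inj₁ a) → refl })
                 (λ { (inj₁ (inj₁ tt)) → refl ; (inj₁ (inj₂ b)) → refl ; (inj₂ (a , inj₂ tt)) → refl ; (inj₂ (a , inj₁ ())) })
    ; auxIso = λ { (inj₁ (inj₁ tt)) → ↔-refl ; (inj₁ (inj₂ b)) → ↔-refl ; (inj₂ (a , inj₂ tt)) → ↔-sym Fin-suc↔ ; (inj₂ (a , inj₁ ())) }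
    ; polEq = λ { (inj₁ (inj₁ tt)) → refl ; (inj₁ (inj₂ b)) → refl ; (inj₂ (a , inj₂ tt)) → refl ; (inj₂ (a , inj₁ ())) }
    ; linkEq = λ { (free (inj₁ a)) → refl ; (free (inj₂ zero)) → refl ; (free (inj₂ (suc b))) → refl
                 ; (prin (inj₁ (inj₁ tt))) → refl ; (aux (inj₁ (inj₁ tt)) a) → refl
                 ; (prin (inj₁ (inj₂ b))) → refl ; (aux (inj₁ (inj₂ b)) a) → refl
                 ; (prin (inj₂ (a , inj₂ tt))) → refl ; (aux (inj₂ (a , inj₂ tt)) (inj₁ tt)) → refl
                 ; (aux (inj₂ (a , inj₂ tt)) (inj₂ b)) → refl
                 ; (prin (inj₂ (a , inj₁ ()))) ; (aux (inj₂ (a , inj₁ ())) _) } }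

-- Split the first leaf off the cocontraction, reduce the contraction against the
-- resulting binary cocontraction, recurse with the contraction created on the rest,
-- and let every binary cocontraction absorb the cocontraction below it.
facing⇛bipartite-Fin : (n m : ℕ) → Facing (Fin n) (Fin m) ⇛ Bipartite (Fin n) (Fin m)
facing⇛bipartite-Fin n zero = facing-coweakening⇛ n
facing⇛bipartite-Fin n (suc m) =
  rule⇛ (unflatten-rule bang ⊤ (Fin m)) K-split to-split
  ◅◅ ≅⇒⇛ to-binary
  ◅◅ plug-⇛ K-binary (facing-binary⇛ n)
  ◅◅ ≅⇒⇛ to-rec
  ◅◅ plug-⇛ K-rec (facing⇛bipartite-Fin n m)
  ◅◅ ≅⇒⇛ to-merge
  ◅◅ plug-⇛ K-merge (disjoint-⇛ n Leaves (λ _ → flatL bang ⊤ (Fin m)) (λ _ → plug idᶜ (flatR bang ⊤ (Fin m)))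
                                (λ _ → rule-at-top⇛ (flatten-rule bang ⊤ (Fin m))))
  ◅◅ ≅⇒⇛ from-merge
  where open GeneralStep n m

module Relabel {A B : Set} {p q : ℕ} (α : A ↔ Fin p) (β : B ↔ Fin q) where
  module α = Inverse α
  module β = Inverse β

  K-relabel : Context (A ⊎ B) (Fin p ⊎ Fin q)
  K-relabel = record { CCell = ⊥ ; cpol = λ () ; CAux = λ () ; partner = partner ; holePartner = hole }
    where
    partner : Port (A ⊎ B) ⊥ (λ ()) → Port (A ⊎ B) ⊥ (λ ()) ⊎ (Fin p ⊎ Fin q)
    partner (free (inj₁ a)) = inj₂ (inj₁ (α.to a))
    partner (free (inj₂ b)) = inj₂ (inj₂ (β.to b))
    hole : Fin p ⊎ Fin q → Port (A ⊎ B) ⊥ (λ ())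
    hole (inj₁ k) = free (inj₁ (α.from k))
    hole (inj₂ k) = free (inj₂ (β.from k))

  to-Fin : Facing A B ≅ plug K-relabel (Facing (Fin p) (Fin q))
  to-Fin = record
    { cellIso = mk↔ₛ′ (λ { ctr → inj₂ ctr ; cctr → inj₂ cctr }) (λ { (inj₂ ctr) → ctr ; (inj₂ cctr) → cctr })
                 (λ { (inj₂ ctr) → refl ; (inj₂ cctr) → refl }) (λ { ctr → refl ; cctr → refl })
    ; auxIso = λ { ctr → α ; cctr → β }
    ; polEq = λ { ctr → refl ; cctr → refl }
    ; linkEq = λ { (free (inj₁ a)) → refl ; (free (inj₂ b)) → refl ; (prin ctr) → refl ; (prin cctr) → refl
                 ; (aux ctr a) → cong (λ z → free (inj₁ z)) (α.strictlyInverseʳ a)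
                 ; (aux cctr b) → cong (λ z → free (inj₂ z)) (β.strictlyInverseʳ b) } }

  toCell : ⊥ ⊎ (Fin p ⊎ Fin q) → A ⊎ B
  toCell (inj₂ (inj₁ k)) = inj₁ (α.from k)
  toCell (inj₂ (inj₂ k)) = inj₂ (β.from k)

  fromCell : A ⊎ B → ⊥ ⊎ (Fin p ⊎ Fin q)
  fromCell (inj₁ a) = inj₂ (inj₁ (α.to a))
  fromCell (inj₂ b) = inj₂ (inj₂ (β.to b))

  from-Fin : plug K-relabel (Bipartite (Fin p) (Fin q)) ≅ Bipartite A B
  from-Fin = record
    { cellIso = mk↔ₛ′ toCell fromCell
                 (λ { (inj₁ a) → cong inj₁ (α.strictlyInverseʳ a) ; (inj₂ b) → cong inj₂ (β.strictlyInverseʳ b) })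
                 (λ { (inj₂ (inj₁ k)) → cong (λ z → inj₂ (inj₁ z)) (α.strictlyInverseˡ k)
                    ; (inj₂ (inj₂ k)) → cong (λ z → inj₂ (inj₂ z)) (β.strictlyInverseˡ k) })
    ; auxIso = λ { (inj₂ (inj₁ k)) → ↔-sym β ; (inj₂ (inj₂ k)) → ↔-sym α }
    ; polEq = λ { (inj₂ (inj₁ k)) → refl ; (inj₂ (inj₂ k)) → refl }
    ; linkEq = λ { (free (inj₁ a)) → cong (λ z → prin (inj₁ z)) (sym (α.strictlyInverseʳ a))
                 ; (free (inj₂ b)) → cong (λ z → prin (inj₂ z)) (sym (β.strictlyInverseʳ b))
                 ; (prin (inj₂ (inj₁ k))) → refl ; (prin (inj₂ (inj₂ k))) → refl
                 ; (aux (inj₂ (inj₁ k)) j) → refl ; (aux (inj₂ (inj₂ k)) j) → refl } }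

facing⇛bipartite : {A B : Set} {p q : ℕ} → A ↔ Fin p → B ↔ Fin q → Facing A B ⇛ Bipartite A B
facing⇛bipartite {p = p} {q} α β =
  ≅⇒⇛ to-Fin ◅◅ plug-⇛ K-relabel (facing⇛bipartite-Fin p q) ◅◅ ≅⇒⇛ from-Fin
  where open Relabel α β

Σ-Fin↔Fin : (a : ℕ) (f : Fin a → ℕ) → Σ ℕ (λ n → Σ (Fin a) (λ x → Fin (f x)) ↔ Fin n)
Σ-Fin↔Fin zero f = 0 , mk↔ₛ′ (λ { (() , _) }) (λ ()) (λ ()) (λ { (() , _) })
Σ-Fin↔Fin (suc a) f with Σ-Fin↔Fin a (λ x → f (suc x))
... | n , e = f zero + n , ↔-trans dec (↔-trans (↔-refl ⊎-↔ e) (↔-sym +↔⊎))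
  where

  dec : Σ (Fin (suc a)) (λ x → Fin (f x)) ↔ (Fin (f zero) ⊎ Σ (Fin a) (λ x → Fin (f (suc x))))
  dec = mk↔ₛ′ (λ { (zero , k) → inj₁ k ; (suc x , k) → inj₂ (x , k) })
              (λ { (inj₁ k) → zero , k ; (inj₂ (x , k)) → suc x , k })
              (λ { (inj₁ k) → refl ; (inj₂ (x , k)) → refl })
              (λ { (zero , k) → refl ; (suc x , k) → refl })


module BushAndFlat (p : Pol) (A : Set) (n : ℕ) (B : Set) where
  Labels : Set
  Labels = ⊤ ⊎ (A ⊎ (Fin n × B))

  auxes : ⊤ ⊎ Fin n → Set
  auxes (inj₁ _) = A ⊎ Fin n
  auxes (inj₂ _) = B

  bushLink : Port Labels (⊤ ⊎ Fin n) auxes → Port Labels (⊤ ⊎ Fin n) auxes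
  bushLink (free (inj₁ tt)) = prin (inj₁ tt)
  bushLink (free (inj₂ (inj₁ α))) = aux (inj₁ tt) (inj₁ α)
  bushLink (free (inj₂ (inj₂ (k , b)))) = aux (inj₂ k) b
  bushLink (prin (inj₁ tt)) = free (inj₁ tt)
  bushLink (aux (inj₁ tt) (inj₁ α)) = free (inj₂ (inj₁ α))
  bushLink (aux (inj₁ tt) (inj₂ k)) = prin (inj₂ k)
  bushLink (prin (inj₂ k)) = aux (inj₁ tt) (inj₂ k)
  bushLink (aux (inj₂ k) b) = free (inj₂ (inj₂ (k , b)))

  bush : Net Labels
  bush = record { Cell = ⊤ ⊎ Fin n ; pol = λ _ → p ; Aux = auxes ; link = bushLink }

  flatAux : ⊤ → Set
  flatAux _ = A ⊎ (Fin n × B)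

  flatLink : Port Labels ⊤ flatAux → Port Labels ⊤ flatAux
  flatLink (free (inj₁ tt)) = prin tt
  flatLink (free (inj₂ w)) = aux tt w
  flatLink (prin tt) = free (inj₁ tt)
  flatLink (aux tt w) = free (inj₂ w)

  flat : Net Labels
  flat = record { Cell = ⊤ ; pol = λ _ → p ; Aux = flatAux ; link = flatLink }

Bush : (p : Pol) (A : Set) (n : ℕ) (B : Set) → Net (⊤ ⊎ (A ⊎ (Fin n × B)))
Bush = BushAndFlat.bush

Flat : (p : Pol) (A : Set) (n : ℕ) (B : Set) → Net (⊤ ⊎ (A ⊎ (Fin n × B)))
Flat = BushAndFlat.flat

module BushBase (p : Pol) (A B : Set) where
  bush≅flat : Bush p A 0 B ≅ Flat p A 0 B
  bush≅flat = record
    { cellIso = mk↔ₛ′ (λ { (inj₁ tt) → tt }) (λ { tt → inj₁ tt }) (λ { tt → refl }) (λ { (inj₁ tt) → refl ; (inj₂ ()) })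
    ; auxIso = λ { (inj₁ tt) → mk↔ₛ′ (λ { (inj₁ α) → inj₁ α }) (λ { (inj₁ α) → inj₁ α ; (inj₂ (() , _)) })
                                    (λ { (inj₁ α) → refl ; (inj₂ (() , _)) }) (λ { (inj₁ α) → refl ; (inj₂ ()) })
                 ; (inj₂ ()) }
    ; polEq = λ { (inj₁ tt) → refl ; (inj₂ ()) }
    ; linkEq = λ { (free (inj₁ tt)) → refl ; (free (inj₂ (inj₁ α))) → refl ; (free (inj₂ (inj₂ (() , _))))
                 ; (prin (inj₁ tt)) → refl ; (prin (inj₂ ())) ; (aux (inj₁ tt) (inj₁ α)) → refl
                 ; (aux (inj₁ tt) (inj₂ ())) ; (aux (inj₂ ()) _) } }

module BushStep (p : Pol) (A : Set) (n : ℕ) (B : Set) where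
  Labels : Set
  Labels = ⊤ ⊎ (A ⊎ (Fin (suc n) × B))

  Interface : Set
  Interface = ⊤ ⊎ ((A ⊎ Fin n) ⊎ B)

  K-absorb : Context Labels Interface
  K-absorb = record { CCell = Fin n ; cpol = λ _ → p ; CAux = λ _ → B ; partner = partner ; holePartner = hole }
    where
    partner : Port Labels (Fin n) (λ _ → B) → Port Labels (Fin n) (λ _ → B) ⊎ Interface
    partner (free (inj₁ tt)) = inj₂ (inj₁ tt)
    partner (free (inj₂ (inj₁ α))) = inj₂ (inj₂ (inj₁ (inj₁ α)))
    partner (free (inj₂ (inj₂ (zero , b)))) = inj₂ (inj₂ (inj₂ b))
    partner (free (inj₂ (inj₂ (suc k , b)))) = inj₁ (aux k b)
    partner (prin k) = inj₂ (inj₂ (inj₁ (inj₂ k)))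
    partner (aux k b) = inj₁ (free (inj₂ (inj₂ (suc k , b))))
    hole : Interface → Port Labels (Fin n) (λ _ → B)
    hole (inj₁ tt) = free (inj₁ tt)
    hole (inj₂ (inj₁ (inj₁ α))) = free (inj₂ (inj₁ α))
    hole (inj₂ (inj₁ (inj₂ k))) = prin k
    hole (inj₂ (inj₂ b)) = free (inj₂ (inj₂ (zero , b)))

  top-aux : (A ⊎ Fin (suc n)) ↔ ((A ⊎ Fin n) ⊎ ⊤)
  top-aux = mk↔ₛ′ (λ { (inj₁ α) → inj₁ (inj₁ α) ; (inj₂ zero) → inj₂ tt ; (inj₂ (suc k)) → inj₁ (inj₂ k) })
               (λ { (inj₁ (inj₁ α)) → inj₁ α ; (inj₂ tt) → inj₂ zero ; (inj₁ (inj₂ k)) → inj₂ (suc k) })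
               (λ { (inj₁ (inj₁ α)) → refl ; (inj₂ tt) → refl ; (inj₁ (inj₂ k)) → refl })
               (λ { (inj₁ α) → refl ; (inj₂ zero) → refl ; (inj₂ (suc k)) → refl })

  to-absorb : Bush p A (suc n) B ≅ plug K-absorb (flatL p (A ⊎ Fin n) B)
  to-absorb = record
    { cellIso = mk↔ₛ′ (λ { (inj₁ tt) → inj₂ top ; (inj₂ zero) → inj₂ sub ; (inj₂ (suc k)) → inj₁ k })
                      (λ { (inj₂ top) → inj₁ tt ; (inj₂ sub) → inj₂ zero ; (inj₁ k) → inj₂ (suc k) })
                 (λ { (inj₂ top) → refl ; (inj₂ sub) → refl ; (inj₁ k) → refl })
                 (λ { (inj₁ tt) → refl ; (inj₂ zero) → refl ; (inj₂ (suc k)) → refl })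
    ; auxIso = λ { (inj₁ tt) → top-aux ; (inj₂ zero) → ↔-refl ; (inj₂ (suc k)) → ↔-refl }
    ; polEq = λ { (inj₁ tt) → refl ; (inj₂ zero) → refl ; (inj₂ (suc k)) → refl }
    ; linkEq = λ { (free (inj₁ tt)) → refl ; (free (inj₂ (inj₁ α))) → refl
                 ; (free (inj₂ (inj₂ (zero , b)))) → refl ; (free (inj₂ (inj₂ (suc k , b)))) → refl
                 ; (prin (inj₁ tt)) → refl ; (aux (inj₁ tt) (inj₁ α)) → refl
                 ; (aux (inj₁ tt) (inj₂ zero)) → refl ; (aux (inj₁ tt) (inj₂ (suc k))) → refl
                 ; (prin (inj₂ zero)) → refl ; (prin (inj₂ (suc k))) → refl
                 ; (aux (inj₂ zero) b) → refl ; (aux (inj₂ (suc k)) b) → refl } }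

  Interface′ : Set
  Interface′ = ⊤ ⊎ ((A ⊎ B) ⊎ (Fin n × B))

  K-rec : Context Labels Interface′
  K-rec = record { CCell = ⊥ ; cpol = λ () ; CAux = λ () ; partner = partner ; holePartner = hole }
    where
    partner : Port Labels ⊥ (λ ()) → Port Labels ⊥ (λ ()) ⊎ Interface′
    partner (free (inj₁ tt)) = inj₂ (inj₁ tt)
    partner (free (inj₂ (inj₁ α))) = inj₂ (inj₂ (inj₁ (inj₁ α)))
    partner (free (inj₂ (inj₂ (zero , b)))) = inj₂ (inj₂ (inj₁ (inj₂ b)))
    partner (free (inj₂ (inj₂ (suc k , b)))) = inj₂ (inj₂ (inj₂ (k , b)))
    hole : Interface′ → Port Labels ⊥ (λ ())
    hole (inj₁ tt) = free (inj₁ tt)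
    hole (inj₂ (inj₁ (inj₁ α))) = free (inj₂ (inj₁ α))
    hole (inj₂ (inj₁ (inj₂ b))) = free (inj₂ (inj₂ (zero , b)))
    hole (inj₂ (inj₂ (k , b))) = free (inj₂ (inj₂ (suc k , b)))

  merged-aux : ((A ⊎ Fin n) ⊎ B) ↔ ((A ⊎ B) ⊎ Fin n)
  merged-aux = mk↔ₛ′ (λ { (inj₁ (inj₁ α)) → inj₁ (inj₁ α) ; (inj₁ (inj₂ k)) → inj₂ k ; (inj₂ b) → inj₁ (inj₂ b) })
             (λ { (inj₁ (inj₁ α)) → inj₁ (inj₁ α) ; (inj₂ k) → inj₁ (inj₂ k) ; (inj₁ (inj₂ b)) → inj₂ b })
             (λ { (inj₁ (inj₁ α)) → refl ; (inj₂ k) → refl ; (inj₁ (inj₂ b)) → refl })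
             (λ { (inj₁ (inj₁ α)) → refl ; (inj₁ (inj₂ k)) → refl ; (inj₂ b) → refl })

  to-rec : plug K-absorb (flatR p (A ⊎ Fin n) B) ≅ plug K-rec (Bush p (A ⊎ B) n B)
  to-rec = record
    { cellIso = mk↔ₛ′ (λ { (inj₂ tt) → inj₂ (inj₁ tt) ; (inj₁ k) → inj₂ (inj₂ k) })
                      (λ { (inj₂ (inj₁ tt)) → inj₂ tt ; (inj₂ (inj₂ k)) → inj₁ k ; (inj₁ ()) })
                 (λ { (inj₂ (inj₁ tt)) → refl ; (inj₂ (inj₂ k)) → refl ; (inj₁ ()) })
                 (λ { (inj₂ tt) → refl ; (inj₁ k) → refl })
    ; auxIso = λ { (inj₂ tt) → merged-aux ; (inj₁ k) → ↔-refl }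
    ; polEq = λ { (inj₂ tt) → refl ; (inj₁ k) → refl }
    ; linkEq = λ { (free (inj₁ tt)) → refl ; (free (inj₂ (inj₁ α))) → refl
                 ; (free (inj₂ (inj₂ (zero , b)))) → refl ; (free (inj₂ (inj₂ (suc k , b)))) → refl
                 ; (prin (inj₂ tt)) → refl ; (aux (inj₂ tt) (inj₁ (inj₁ α))) → refl
                 ; (aux (inj₂ tt) (inj₁ (inj₂ k))) → refl ; (aux (inj₂ tt) (inj₂ b)) → refl
                 ; (prin (inj₁ k)) → refl ; (aux (inj₁ k) b) → refl } }

  flat-aux : ((A ⊎ B) ⊎ (Fin n × B)) ↔ (A ⊎ (Fin (suc n) × B))
  flat-aux = mk↔ₛ′ (λ { (inj₁ (inj₁ α)) → inj₁ α ; (inj₁ (inj₂ b)) → inj₂ (zero , b) ; (inj₂ (k , b)) → inj₂ (suc k , b) })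
             (λ { (inj₁ α) → inj₁ (inj₁ α) ; (inj₂ (zero , b)) → inj₁ (inj₂ b) ; (inj₂ (suc k , b)) → inj₂ (k , b) })
             (λ { (inj₁ α) → refl ; (inj₂ (zero , b)) → refl ; (inj₂ (suc k , b)) → refl })
             (λ { (inj₁ (inj₁ α)) → refl ; (inj₁ (inj₂ b)) → refl ; (inj₂ (k , b)) → refl })

  from-rec : plug K-rec (Flat p (A ⊎ B) n B) ≅ Flat p A (suc n) B
  from-rec = record
    { cellIso = mk↔ₛ′ (λ { (inj₂ tt) → tt }) (λ { tt → inj₂ tt }) (λ { tt → refl }) (λ { (inj₂ tt) → refl })
    ; auxIso = λ { (inj₂ tt) → flat-aux }
    ; polEq = λ { (inj₂ tt) → refl }
    ; linkEq = λ { (free (inj₁ tt)) → refl ; (free (inj₂ (inj₁ α))) → refl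
                 ; (free (inj₂ (inj₂ (zero , b)))) → refl ; (free (inj₂ (inj₂ (suc k , b)))) → refl
                 ; (prin (inj₂ tt)) → refl ; (aux (inj₂ tt) (inj₁ (inj₁ α))) → refl
                 ; (aux (inj₂ tt) (inj₁ (inj₂ b))) → refl ; (aux (inj₂ tt) (inj₂ (k , b))) → refl } }

bush⇛flat : (p : Pol) (A : Set) (n : ℕ) (B : Set) → Bush p A n B ⇛ Flat p A n B
bush⇛flat p A zero B = ≅⇒⇛ (BushBase.bush≅flat p A B)
bush⇛flat p A (suc n) B =
  rule⇛ (flatten-rule p (A ⊎ Fin n) B) K-absorb to-absorb
  ◅◅ ≅⇒⇛ to-rec
  ◅◅ plug-⇛ K-rec (bush⇛flat p (A ⊎ B) n B)
  ◅◅ ≅⇒⇛ from-rec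
  where open BushStep p A n B

data Removed {n : ℕ} (x : Fin n) : Fin n → Set where
  is-removed : Removed x x
  kept       : (j : n ∖ x) → Removed x (proj₁ j)

removed-by : {n : ℕ} {x j : Fin n} → Dec (j ≡ x) → Removed x j
removed-by {j = j} (yes refl) = is-removed
removed-by {j = j} (no j≢x) = kept (j , fromWitnessFalse j≢x)

removed? : {n : ℕ} (x j : Fin n) → Removed x j
removed? x j = removed-by (j ≟ x)

removed?-self : {n : ℕ} (x : Fin n) → removed? x x ≡ is-removed
removed?-self x with x ≟ x
... | yes refl = refl
... | no x≢x = ⊥-elim (x≢x refl)

removed?-kept : {n : ℕ} {x : Fin n} (j : n ∖ x) → removed? x (proj₁ j) ≡ kept j
removed?-kept {x = x} (j , j≢x) = removed-by-kept (j ≟ x)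
  where

  removed-by-kept : (d : Dec (j ≡ x)) → removed-by d ≡ kept (j , j≢x)
  removed-by-kept (yes j≡x) = ⊥-elim (toWitnessFalse j≢x j≡x)
  removed-by-kept (no _) = cong (λ p → kept (j , p)) (T-irrelevant _ j≢x)

module _ {n : ℕ} (x : Fin n) (P : Fin n → Set) where
  split : {j : Fin n} → Removed x j → P j → Σ (n ∖ x) (λ j → P (proj₁ j)) ⊎ P x
  split is-removed p = inj₂ p
  split (kept j) p = inj₁ (j , p)

  unsplit : Σ (n ∖ x) (λ j → P (proj₁ j)) ⊎ P x → Σ (Fin n) P
  unsplit (inj₁ (j , p)) = (proj₁ j , p)
  unsplit (inj₂ p) = (x , p)

  unsplit-split : {j : Fin n} (r : Removed x j) (p : P j) → unsplit (split r p) ≡ (j , p)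
  unsplit-split is-removed p = refl
  unsplit-split (kept j) p = refl

  Σ-split : Σ (Fin n) P ↔ (Σ (n ∖ x) (λ j → P (proj₁ j)) ⊎ P x)
  Σ-split = mk↔ₛ′ (λ { (j , p) → split (removed? x j) p }) unsplit
    (λ { (inj₁ (j , p)) → cong (λ r → split r p) (removed?-kept j)
       ; (inj₂ p) → cong (λ r → split r p) (removed?-self x) })
    (λ { (j , p) → unsplit-split (removed? x j) p })

module Connection {a b a' b' : ℕ} (R : Multirel (Fin a) (Fin b)) (o : Fin b)
                  (S : Multirel (Fin a') (Fin b')) (i : Fin a') where
  Labels : Set
  Labels = (Fin a ⊎ (a' ∖ i)) ⊎ ((b ∖ o) ⊎ Fin b')

  LeavesO : Set
  LeavesO = Σ (Fin a) (λ x → Fin (R (x , o)))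

  LeavesI : Set
  LeavesI = Σ (Fin b') (λ y → Fin (S (i , y)))

  OtherR : Fin a → Set
  OtherR x = Σ (b ∖ o) (λ y → Fin (R (x , proj₁ y)))

  OtherS : Fin b' → Set
  OtherS y = Σ (a' ∖ i) (λ x → Fin (S (proj₁ x , y)))

  -- The wires of each input x of R are split into those going to o and the rest,
  -- dually for each output y of S and i; the former are the leaves of the redex.
  data CellA : Set where
    inR  : Fin a → CellA
    outR : b ∖ o → CellA
    inS  : a' ∖ i → CellA
    outS : Fin b' → CellA

  AuxA : CellA → Set
  AuxA (inR x) = OtherR x ⊎ Fin (R (x , o))
  AuxA (outR y) = Σ (Fin a) (λ x → Fin (R (x , proj₁ y)))
  AuxA (inS x) = Σ (Fin b') (λ y → Fin (S (proj₁ x , y)))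
  AuxA (outS y) = OtherS y ⊎ Fin (S (i , y))

  polA : CellA → Pol
  polA (inR _) = qm
  polA (outR _) = bang
  polA (inS _) = qm
  polA (outS _) = bang

  PortA : Set
  PortA = Port Labels CellA AuxA

  partnerA : PortA → PortA ⊎ (LeavesI ⊎ LeavesO)
  partnerA (free (inj₁ (inj₁ x))) = inj₁ (prin (inR x))
  partnerA (free (inj₁ (inj₂ x))) = inj₁ (prin (inS x))
  partnerA (free (inj₂ (inj₁ y))) = inj₁ (prin (outR y))
  partnerA (free (inj₂ (inj₂ y))) = inj₁ (prin (outS y))
  partnerA (prin (inR x)) = inj₁ (free (inj₁ (inj₁ x)))
  partnerA (prin (outR y)) = inj₁ (free (inj₂ (inj₁ y)))
  partnerA (prin (inS x)) = inj₁ (free (inj₁ (inj₂ x)))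
  partnerA (prin (outS y)) = inj₁ (free (inj₂ (inj₂ y)))
  partnerA (aux (inR x) (inj₁ (y , k))) = inj₁ (aux (outR y) (x , k))
  partnerA (aux (inR x) (inj₂ k)) = inj₂ (inj₂ (x , k))
  partnerA (aux (outR y) (x , k)) = inj₁ (aux (inR x) (inj₁ (y , k)))
  partnerA (aux (inS x) (y , l)) = inj₁ (aux (outS y) (inj₁ (x , l)))
  partnerA (aux (outS y) (inj₁ (x , l))) = inj₁ (aux (inS x) (y , l))
  partnerA (aux (outS y) (inj₂ l)) = inj₂ (inj₁ (y , l))

  holeA : LeavesI ⊎ LeavesO → PortA
  holeA (inj₁ (y , l)) = aux (outS y) (inj₂ l)
  holeA (inj₂ (x , k)) = aux (inR x) (inj₂ k)

  K-facing : Context Labels (LeavesI ⊎ LeavesO)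
  K-facing = record { CCell = CellA ; cpol = polA ; CAux = AuxA ; partner = partnerA ; holePartner = holeA }

  Connected FacingIn : Net Labels
  Connected = connect R o S i
  FacingIn = plug K-facing (Facing LeavesI LeavesO)
  module FacingIn = Plugging K-facing (Facing LeavesI LeavesO)

  cellOfOutR : {y : Fin b} → Removed o y → FacingIn.Cells
  cellOfOutR is-removed = inj₂ cctr
  cellOfOutR (kept y) = inj₁ (outR y)

  cellOfInS : {x : Fin a'} → Removed i x → FacingIn.Cells
  cellOfInS is-removed = inj₂ ctr
  cellOfInS (kept x) = inj₁ (inS x)

  toA : Cell Connected → FacingIn.Cells
  toA (inj₁ (inj₁ x)) = inj₁ (inR x)
  toA (inj₁ (inj₂ y)) = cellOfOutR (removed? o y)
  toA (inj₂ (inj₁ x)) = cellOfInS (removed? i x)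
  toA (inj₂ (inj₂ y)) = inj₁ (outS y)

  fromA : FacingIn.Cells → Cell Connected
  fromA (inj₁ (inR x)) = inj₁ (inj₁ x)
  fromA (inj₁ (outR y)) = inj₁ (inj₂ (proj₁ y))
  fromA (inj₁ (inS x)) = inj₂ (inj₁ (proj₁ x))
  fromA (inj₁ (outS y)) = inj₂ (inj₂ y)
  fromA (inj₂ ctr) = inj₂ (inj₁ i)
  fromA (inj₂ cctr) = inj₁ (inj₂ o)

  fromA-cellOfOutR : {y : Fin b} (r : Removed o y) → fromA (cellOfOutR r) ≡ inj₁ (inj₂ y)
  fromA-cellOfOutR is-removed = refl
  fromA-cellOfOutR (kept y) = refl

  fromA-cellOfInS : {x : Fin a'} (r : Removed i x) → fromA (cellOfInS r) ≡ inj₂ (inj₁ x)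
  fromA-cellOfInS is-removed = refl
  fromA-cellOfInS (kept x) = refl

  cellsA : Cell Connected ↔ FacingIn.Cells
  cellsA = mk↔ₛ′ toA fromA
    (λ { (inj₁ (inR x)) → refl
       ; (inj₁ (outR y)) → cong cellOfOutR (removed?-kept y)
       ; (inj₁ (inS x)) → cong cellOfInS (removed?-kept x)
       ; (inj₁ (outS y)) → refl
       ; (inj₂ ctr) → cong cellOfInS (removed?-self i)
       ; (inj₂ cctr) → cong cellOfOutR (removed?-self o) })
    (λ { (inj₁ (inj₁ x)) → refl
       ; (inj₁ (inj₂ y)) → fromA-cellOfOutR (removed? o y)
       ; (inj₂ (inj₁ x)) → fromA-cellOfInS (removed? i x)
       ; (inj₂ (inj₂ y)) → refl })

  auxOfOutR : {y : Fin b} (r : Removed o y) →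
              Σ (Fin a) (λ x → Fin (R (x , y))) ↔ FacingIn.Auxes (cellOfOutR r)
  auxOfOutR is-removed = ↔-refl
  auxOfOutR (kept y) = ↔-refl

  auxOfInS : {x : Fin a'} (r : Removed i x) →
             Σ (Fin b') (λ y → Fin (S (x , y))) ↔ FacingIn.Auxes (cellOfInS r)
  auxOfInS is-removed = ↔-refl
  auxOfInS (kept x) = ↔-refl

  auxesA : (c : Cell Connected) → Aux Connected c ↔ FacingIn.Auxes (toA c)
  auxesA (inj₁ (inj₁ x)) = Σ-split o (λ y → Fin (R (x , y)))
  auxesA (inj₁ (inj₂ y)) = auxOfOutR (removed? o y)
  auxesA (inj₂ (inj₁ x)) = auxOfInS (removed? i x)
  auxesA (inj₂ (inj₂ y)) = Σ-split i (λ x → Fin (S (x , y)))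

  polOfOutR : {y : Fin b} (r : Removed o y) → pol FacingIn (cellOfOutR r) ≡ bang
  polOfOutR is-removed = refl
  polOfOutR (kept y) = refl

  polOfInS : {x : Fin a'} (r : Removed i x) → pol FacingIn (cellOfInS r) ≡ qm
  polOfInS is-removed = refl
  polOfInS (kept x) = refl

  polsA : (c : Cell Connected) → pol FacingIn (toA c) ≡ pol Connected c
  polsA (inj₁ (inj₁ x)) = refl
  polsA (inj₁ (inj₂ y)) = polOfOutR (removed? o y)
  polsA (inj₂ (inj₁ x)) = polOfInS (removed? i x)
  polsA (inj₂ (inj₂ y)) = refl

  portsA : Port Labels (Cell Connected) (Aux Connected) → FacingIn.Ports
  portsA = portMap Connected FacingIn cellsA auxesA

  linksA : ∀ p → link FacingIn (portsA p) ≡ portsA (link Connected p)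
  linksA (free (inj₁ (inj₁ x))) = refl
  linksA (free (inj₁ (inj₂ x))) = cong prin (sym (cong cellOfInS (removed?-kept x)))
  linksA (free (inj₂ (inj₁ y))) = cong prin (sym (cong cellOfOutR (removed?-kept y)))
  linksA (free (inj₂ (inj₂ y))) = refl
  linksA (prin (inj₁ (inj₁ x))) = refl
  linksA (aux (inj₁ (inj₁ x)) (y , k)) with y ≟ o
  ... | yes refl = refl
  ... | no _ = refl
  linksA (prin (inj₁ (inj₂ y))) with y ≟ o
  ... | yes refl = cong prin (sym (cong cellOfInS (removed?-self i)))
  ... | no _ = refl
  linksA (aux (inj₁ (inj₂ y)) (x , k)) with y ≟ o
  ... | yes refl = refl
  ... | no _ = refl
  linksA (prin (inj₂ (inj₁ x))) with x ≟ i
  ... | yes refl = cong prin (sym (cong cellOfOutR (removed?-self o)))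
  ... | no _ = refl
  linksA (aux (inj₂ (inj₁ x)) (y , l)) with x ≟ i
  ... | yes refl = refl
  ... | no _ = refl
  linksA (prin (inj₂ (inj₂ y))) = refl
  linksA (aux (inj₂ (inj₂ y)) (x , l)) with x ≟ i
  ... | yes refl = refl
  ... | no _ = refl

  connect≅facing : Connected ≅ FacingIn
  connect≅facing = record { cellIso = cellsA ; auxIso = auxesA ; polEq = polsA ; linkEq = linksA }

  -- Once the redex is reduced, input x of R and the new contractions at its leaves towards o form a bush.
  BushLabelsR : Fin a → Set
  BushLabelsR x = ⊤ ⊎ (OtherR x ⊎ (Fin (R (x , o)) × LeavesI))

  BushR FlatR : (x : Fin a) → Net (BushLabelsR x)
  BushR x = Bush qm (OtherR x) (R (x , o)) LeavesI
  FlatR x = Flat qm (OtherR x) (R (x , o)) LeavesI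

  data CellB : Set where
    outR : b ∖ o → CellB
    inS  : a' ∖ i → CellB
    outS : Fin b' → CellB
    at   : LeavesI → CellB

  AuxB : CellB → Set
  AuxB (outR y) = Σ (Fin a) (λ x → Fin (R (x , proj₁ y)))
  AuxB (inS x) = Σ (Fin b') (λ y → Fin (S (proj₁ x , y)))
  AuxB (outS y) = OtherS y ⊎ Fin (S (i , y))
  AuxB (at g) = LeavesO

  polB : CellB → Pol
  polB (outR _) = bang
  polB (inS _) = qm
  polB (outS _) = bang
  polB (at _) = bang

  PortB HoleB : Set
  PortB = Port Labels CellB AuxB
  HoleB = Σ (Fin a) BushLabelsR

  partnerB : PortB → PortB ⊎ HoleB
  partnerB (free (inj₁ (inj₁ x))) = inj₂ (x , inj₁ tt)
  partnerB (free (inj₁ (inj₂ x))) = inj₁ (prin (inS x))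
  partnerB (free (inj₂ (inj₁ y))) = inj₁ (prin (outR y))
  partnerB (free (inj₂ (inj₂ y))) = inj₁ (prin (outS y))
  partnerB (prin (outR y)) = inj₁ (free (inj₂ (inj₁ y)))
  partnerB (aux (outR y) (x , k)) = inj₂ (x , inj₂ (inj₁ (y , k)))
  partnerB (prin (inS x)) = inj₁ (free (inj₁ (inj₂ x)))
  partnerB (aux (inS x) (y , l)) = inj₁ (aux (outS y) (inj₁ (x , l)))
  partnerB (prin (outS y)) = inj₁ (free (inj₂ (inj₂ y)))
  partnerB (aux (outS y) (inj₁ (x , l))) = inj₁ (aux (inS x) (y , l))
  partnerB (aux (outS y) (inj₂ l)) = inj₁ (prin (at (y , l)))
  partnerB (prin (at (y , l))) = inj₁ (aux (outS y) (inj₂ l))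
  partnerB (aux (at g) (x , k)) = inj₂ (x , inj₂ (inj₂ (k , g)))

  holeB : HoleB → PortB
  holeB (x , inj₁ tt) = free (inj₁ (inj₁ x))
  holeB (x , inj₂ (inj₁ (y , k))) = aux (outR y) (x , k)
  holeB (x , inj₂ (inj₂ (k , g))) = aux (at g) (x , k)

  K-bushesR : Context Labels HoleB
  K-bushesR = record { CCell = CellB ; cpol = polB ; CAux = AuxB ; partner = partnerB ; holePartner = holeB }

  BipartiteIn BushesRIn : Net Labels
  BipartiteIn = plug K-facing (Bipartite LeavesI LeavesO)
  BushesRIn = plug K-bushesR (Disjoint BushLabelsR BushR)
  module BipartiteIn = Plugging K-facing (Bipartite LeavesI LeavesO)
  module BushesRIn = Plugging K-bushesR (Disjoint BushLabelsR BushR)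

  toB : BipartiteIn.Cells → BushesRIn.Cells
  toB (inj₁ (inR x)) = inj₂ (x , inj₁ tt)
  toB (inj₁ (outR y)) = inj₁ (outR y)
  toB (inj₁ (inS x)) = inj₁ (inS x)
  toB (inj₁ (outS y)) = inj₁ (outS y)
  toB (inj₂ (inj₁ g)) = inj₁ (at g)
  toB (inj₂ (inj₂ (x , k))) = inj₂ (x , inj₂ k)

  fromB : BushesRIn.Cells → BipartiteIn.Cells
  fromB (inj₂ (x , inj₁ tt)) = inj₁ (inR x)
  fromB (inj₁ (outR y)) = inj₁ (outR y)
  fromB (inj₁ (inS x)) = inj₁ (inS x)
  fromB (inj₁ (outS y)) = inj₁ (outS y)
  fromB (inj₁ (at g)) = inj₂ (inj₁ g)
  fromB (inj₂ (x , inj₂ k)) = inj₂ (inj₂ (x , k))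

  cellsB : BipartiteIn.Cells ↔ BushesRIn.Cells
  cellsB = mk↔ₛ′ toB fromB
    (λ { (inj₂ (x , inj₁ tt)) → refl ; (inj₁ (outR y)) → refl ; (inj₁ (inS x)) → refl
       ; (inj₁ (outS y)) → refl ; (inj₁ (at g)) → refl ; (inj₂ (x , inj₂ k)) → refl })
    (λ { (inj₁ (inR x)) → refl ; (inj₁ (outR y)) → refl ; (inj₁ (inS x)) → refl
       ; (inj₁ (outS y)) → refl ; (inj₂ (inj₁ g)) → refl ; (inj₂ (inj₂ (x , k))) → refl })

  auxesB : (c : BipartiteIn.Cells) → BipartiteIn.Auxes c ↔ BushesRIn.Auxes (toB c)
  auxesB (inj₁ (inR x)) = ↔-refl
  auxesB (inj₁ (outR y)) = ↔-refl
  auxesB (inj₁ (inS x)) = ↔-refl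
  auxesB (inj₁ (outS y)) = ↔-refl
  auxesB (inj₂ (inj₁ g)) = ↔-refl
  auxesB (inj₂ (inj₂ (x , k))) = ↔-refl

  bipartite≅bushesR : BipartiteIn ≅ BushesRIn
  bipartite≅bushesR = record
    { cellIso = cellsB ; auxIso = auxesB
    ; polEq = λ { (inj₁ (inR x)) → refl ; (inj₁ (outR y)) → refl ; (inj₁ (inS x)) → refl
                ; (inj₁ (outS y)) → refl ; (inj₂ (inj₁ g)) → refl ; (inj₂ (inj₂ (x , k))) → refl }
    ; linkEq = λ
      { (free (inj₁ (inj₁ x))) → refl ; (free (inj₁ (inj₂ x))) → refl
      ; (free (inj₂ (inj₁ y))) → refl ; (free (inj₂ (inj₂ y))) → refl
      ; (prin (inj₁ (inR x))) → refl
      ; (aux (inj₁ (inR x)) (inj₁ (y , k))) → refl ; (aux (inj₁ (inR x)) (inj₂ k)) → refl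
      ; (prin (inj₁ (outR y))) → refl ; (aux (inj₁ (outR y)) (x , k)) → refl
      ; (prin (inj₁ (inS x))) → refl ; (aux (inj₁ (inS x)) (y , l)) → refl
      ; (prin (inj₁ (outS y))) → refl
      ; (aux (inj₁ (outS y)) (inj₁ (x , l))) → refl ; (aux (inj₁ (outS y)) (inj₂ l)) → refl
      ; (prin (inj₂ (inj₁ g))) → refl ; (aux (inj₂ (inj₁ g)) (x , k)) → refl
      ; (prin (inj₂ (inj₂ (x , k)))) → refl ; (aux (inj₂ (inj₂ (x , k))) g) → refl } }

  -- Once those bushes are flat, output y of S and the new cocontractions at its
  -- leaves towards i form a bush in turn.
  BushLabelsS : Fin b' → Set
  BushLabelsS y = ⊤ ⊎ (OtherS y ⊎ (Fin (S (i , y)) × LeavesO))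

  BushS FlatS : (y : Fin b') → Net (BushLabelsS y)
  BushS y = Bush bang (OtherS y) (S (i , y)) LeavesO
  FlatS y = Flat bang (OtherS y) (S (i , y)) LeavesO

  data CellC : Set where
    inR  : Fin a → CellC
    outR : b ∖ o → CellC
    inS  : a' ∖ i → CellC

  AuxC : CellC → Set
  AuxC (inR x) = OtherR x ⊎ (Fin (R (x , o)) × LeavesI)
  AuxC (outR y) = Σ (Fin a) (λ x → Fin (R (x , proj₁ y)))
  AuxC (inS x) = Σ (Fin b') (λ y → Fin (S (proj₁ x , y)))

  polC : CellC → Pol
  polC (inR _) = qm
  polC (outR _) = bang
  polC (inS _) = qm

  PortC HoleC : Set
  PortC = Port Labels CellC AuxC
  HoleC = Σ (Fin b') BushLabelsS

  partnerC : PortC → PortC ⊎ HoleC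
  partnerC (free (inj₁ (inj₁ x))) = inj₁ (prin (inR x))
  partnerC (free (inj₁ (inj₂ x))) = inj₁ (prin (inS x))
  partnerC (free (inj₂ (inj₁ y))) = inj₁ (prin (outR y))
  partnerC (free (inj₂ (inj₂ y))) = inj₂ (y , inj₁ tt)
  partnerC (prin (inR x)) = inj₁ (free (inj₁ (inj₁ x)))
  partnerC (aux (inR x) (inj₁ (y , k))) = inj₁ (aux (outR y) (x , k))
  partnerC (aux (inR x) (inj₂ (k , (y , l)))) = inj₂ (y , inj₂ (inj₂ (l , (x , k))))
  partnerC (prin (outR y)) = inj₁ (free (inj₂ (inj₁ y)))
  partnerC (aux (outR y) (x , k)) = inj₁ (aux (inR x) (inj₁ (y , k)))
  partnerC (prin (inS x)) = inj₁ (free (inj₁ (inj₂ x)))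
  partnerC (aux (inS x) (y , l)) = inj₂ (y , inj₂ (inj₁ (x , l)))

  holeC : HoleC → PortC
  holeC (y , inj₁ tt) = free (inj₂ (inj₂ y))
  holeC (y , inj₂ (inj₁ (x , l))) = aux (inS x) (y , l)
  holeC (y , inj₂ (inj₂ (l , (x , k)))) = aux (inR x) (inj₂ (k , (y , l)))

  K-bushesS : Context Labels HoleC
  K-bushesS = record { CCell = CellC ; cpol = polC ; CAux = AuxC ; partner = partnerC ; holePartner = holeC }

  FlatsRIn BushesSIn : Net Labels
  FlatsRIn = plug K-bushesR (Disjoint BushLabelsR FlatR)
  BushesSIn = plug K-bushesS (Disjoint BushLabelsS BushS)
  module FlatsRIn = Plugging K-bushesR (Disjoint BushLabelsR FlatR)
  module BushesSIn = Plugging K-bushesS (Disjoint BushLabelsS BushS)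

  toC : FlatsRIn.Cells → BushesSIn.Cells
  toC (inj₁ (outR y)) = inj₁ (outR y)
  toC (inj₁ (inS x)) = inj₁ (inS x)
  toC (inj₁ (outS y)) = inj₂ (y , inj₁ tt)
  toC (inj₁ (at (y , l))) = inj₂ (y , inj₂ l)
  toC (inj₂ (x , tt)) = inj₁ (inR x)

  fromC : BushesSIn.Cells → FlatsRIn.Cells
  fromC (inj₁ (outR y)) = inj₁ (outR y)
  fromC (inj₁ (inS x)) = inj₁ (inS x)
  fromC (inj₂ (y , inj₁ tt)) = inj₁ (outS y)
  fromC (inj₂ (y , inj₂ l)) = inj₁ (at (y , l))
  fromC (inj₁ (inR x)) = inj₂ (x , tt)

  cellsC : FlatsRIn.Cells ↔ BushesSIn.Cells
  cellsC = mk↔ₛ′ toC fromC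
    (λ { (inj₁ (outR y)) → refl ; (inj₁ (inS x)) → refl ; (inj₂ (y , inj₁ tt)) → refl
       ; (inj₂ (y , inj₂ l)) → refl ; (inj₁ (inR x)) → refl })
    (λ { (inj₁ (outR y)) → refl ; (inj₁ (inS x)) → refl ; (inj₁ (outS y)) → refl
       ; (inj₁ (at (y , l))) → refl ; (inj₂ (x , tt)) → refl })

  auxesC : (c : FlatsRIn.Cells) → FlatsRIn.Auxes c ↔ BushesSIn.Auxes (toC c)
  auxesC (inj₁ (outR y)) = ↔-refl
  auxesC (inj₁ (inS x)) = ↔-refl
  auxesC (inj₁ (outS y)) = ↔-refl
  auxesC (inj₁ (at (y , l))) = ↔-refl
  auxesC (inj₂ (x , tt)) = ↔-refl

  flatsR≅bushesS : FlatsRIn ≅ BushesSIn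
  flatsR≅bushesS = record
    { cellIso = cellsC ; auxIso = auxesC
    ; polEq = λ { (inj₁ (outR y)) → refl ; (inj₁ (inS x)) → refl ; (inj₁ (outS y)) → refl
                ; (inj₁ (at (y , l))) → refl ; (inj₂ (x , tt)) → refl }
    ; linkEq = λ
      { (free (inj₁ (inj₁ x))) → refl ; (free (inj₁ (inj₂ x))) → refl
      ; (free (inj₂ (inj₁ y))) → refl ; (free (inj₂ (inj₂ y))) → refl
      ; (prin (inj₁ (outR y))) → refl ; (aux (inj₁ (outR y)) (x , k)) → refl
      ; (prin (inj₁ (inS x))) → refl ; (aux (inj₁ (inS x)) (y , l)) → refl
      ; (prin (inj₁ (outS y))) → refl
      ; (aux (inj₁ (outS y)) (inj₁ (x , l))) → refl ; (aux (inj₁ (outS y)) (inj₂ l)) → refl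
      ; (prin (inj₁ (at (y , l)))) → refl ; (aux (inj₁ (at (y , l))) (x , k)) → refl
      ; (prin (inj₂ (x , tt))) → refl
      ; (aux (inj₂ (x , tt)) (inj₁ (y , k))) → refl
      ; (aux (inj₂ (x , tt)) (inj₂ (k , (y , l)))) → refl } }

  -- Each of the R (x , o) * S (i , y) paths x → o = i → y becomes one wire.
  T : Multirel (Fin a ⊎ (a' ∖ i)) ((b ∖ o) ⊎ Fin b')
  T (inj₁ x , inj₁ y) = R (x , proj₁ y)
  T (inj₁ x , inj₂ y) = R (x , o) * S (i , y)
  T (inj₂ x , inj₁ y) = 0
  T (inj₂ x , inj₂ y) = S (proj₁ x , y)

  FlatsSIn : Net Labels
  FlatsSIn = plug K-bushesS (Disjoint BushLabelsS FlatS)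
  module FlatsSIn = Plugging K-bushesS (Disjoint BushLabelsS FlatS)

  toD : FlatsSIn.Cells → Cell (Routing T)
  toD (inj₁ (inR x)) = inj₁ (inj₁ x)
  toD (inj₁ (inS x)) = inj₁ (inj₂ x)
  toD (inj₁ (outR y)) = inj₂ (inj₁ y)
  toD (inj₂ (y , tt)) = inj₂ (inj₂ y)

  fromD : Cell (Routing T) → FlatsSIn.Cells
  fromD (inj₁ (inj₁ x)) = inj₁ (inR x)
  fromD (inj₁ (inj₂ x)) = inj₁ (inS x)
  fromD (inj₂ (inj₁ y)) = inj₁ (outR y)
  fromD (inj₂ (inj₂ y)) = inj₂ (y , tt)

  cellsD : FlatsSIn.Cells ↔ Cell (Routing T)
  cellsD = mk↔ₛ′ toD fromD
    (λ { (inj₁ (inj₁ x)) → refl ; (inj₁ (inj₂ x)) → refl ; (inj₂ (inj₁ y)) → refl ; (inj₂ (inj₂ y)) → refl })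
    (λ { (inj₁ (inR x)) → refl ; (inj₁ (inS x)) → refl ; (inj₁ (outR y)) → refl ; (inj₂ (y , tt)) → refl })

  routingAux-inR : (x : Fin a) →
             (OtherR x ⊎ (Fin (R (x , o)) × LeavesI)) ↔ Σ ((b ∖ o) ⊎ Fin b') (λ w → Fin (T (inj₁ x , w)))
  routingAux-inR x = mk↔ₛ′ to from
    (λ { (inj₁ y , c) → refl
       ; (inj₂ y , c) → cong (λ z → (inj₂ y , z)) (combine-remQuot {R (x , o)} (S (i , y)) c) })
    (λ { (inj₁ (y , k)) → refl
       ; (inj₂ (k , (y , l))) → cong (λ r → inj₂ (proj₁ r , (y , proj₂ r)))
                                     (remQuot-combine {R (x , o)} {S (i , y)} k l) })
    where
    to : OtherR x ⊎ (Fin (R (x , o)) × LeavesI) → Σ ((b ∖ o) ⊎ Fin b') (λ w → Fin (T (inj₁ x , w)))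
    to (inj₁ (y , k)) = (inj₁ y , k)
    to (inj₂ (k , (y , l))) = (inj₂ y , combine {R (x , o)} {S (i , y)} k l)
    from : Σ ((b ∖ o) ⊎ Fin b') (λ w → Fin (T (inj₁ x , w))) → OtherR x ⊎ (Fin (R (x , o)) × LeavesI)
    from (inj₁ y , c) = inj₁ (y , c)
    from (inj₂ y , c) = let (k , l) = remQuot {R (x , o)} (S (i , y)) c in inj₂ (k , (y , l))

  routingAux-outS : (y : Fin b') →
              (OtherS y ⊎ (Fin (S (i , y)) × LeavesO)) ↔ Σ (Fin a ⊎ (a' ∖ i)) (λ u → Fin (T (u , inj₂ y)))
  routingAux-outS y = mk↔ₛ′ to from
    (λ { (inj₂ x , l) → refl
       ; (inj₁ x , c) → cong (λ z → (inj₁ x , z)) (combine-remQuot {R (x , o)} (S (i , y)) c) })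
    (λ { (inj₁ (x , l)) → refl
       ; (inj₂ (l , (x , k))) → cong (λ r → inj₂ (proj₂ r , (x , proj₁ r)))
                                     (remQuot-combine {R (x , o)} {S (i , y)} k l) })
    where
    to : OtherS y ⊎ (Fin (S (i , y)) × LeavesO) → Σ (Fin a ⊎ (a' ∖ i)) (λ u → Fin (T (u , inj₂ y)))
    to (inj₁ (x , l)) = (inj₂ x , l)
    to (inj₂ (l , (x , k))) = (inj₁ x , combine {R (x , o)} {S (i , y)} k l)
    from : Σ (Fin a ⊎ (a' ∖ i)) (λ u → Fin (T (u , inj₂ y))) → OtherS y ⊎ (Fin (S (i , y)) × LeavesO)
    from (inj₂ x , l) = inj₁ (x , l)
    from (inj₁ x , c) = let (k , l) = remQuot {R (x , o)} (S (i , y)) c in inj₂ (l , (x , k))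

  routingAux-inS : (x : a' ∖ i) →
             Σ (Fin b') (λ y → Fin (S (proj₁ x , y))) ↔ Σ ((b ∖ o) ⊎ Fin b') (λ w → Fin (T (inj₂ x , w)))
  routingAux-inS x = mk↔ₛ′ (λ { (y , l) → (inj₂ y , l) }) (λ { (inj₂ y , l) → (y , l) ; (inj₁ y , ()) })
                     (λ { (inj₂ y , l) → refl ; (inj₁ y , ()) }) (λ { (y , l) → refl })

  routingAux-outR : (y : b ∖ o) →
              Σ (Fin a) (λ x → Fin (R (x , proj₁ y))) ↔ Σ (Fin a ⊎ (a' ∖ i)) (λ u → Fin (T (u , inj₁ y)))
  routingAux-outR y = mk↔ₛ′ (λ { (x , k) → (inj₁ x , k) }) (λ { (inj₁ x , k) → (x , k) ; (inj₂ x , ()) })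
                      (λ { (inj₁ x , k) → refl ; (inj₂ x , ()) }) (λ { (x , k) → refl })

  auxesD : (c : FlatsSIn.Cells) → FlatsSIn.Auxes c ↔ Aux (Routing T) (toD c)
  auxesD (inj₁ (inR x)) = routingAux-inR x
  auxesD (inj₁ (inS x)) = routingAux-inS x
  auxesD (inj₁ (outR y)) = routingAux-outR y
  auxesD (inj₂ (y , tt)) = routingAux-outS y

  flatsS≅routing : FlatsSIn ≅ Routing T
  flatsS≅routing = record
    { cellIso = cellsD ; auxIso = auxesD
    ; polEq = λ { (inj₁ (inR x)) → refl ; (inj₁ (inS x)) → refl ; (inj₁ (outR y)) → refl ; (inj₂ (y , tt)) → refl }
    ; linkEq = λ
      { (free (inj₁ (inj₁ x))) → refl ; (free (inj₁ (inj₂ x))) → refl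
      ; (free (inj₂ (inj₁ y))) → refl ; (free (inj₂ (inj₂ y))) → refl
      ; (prin (inj₁ (inR x))) → refl
      ; (aux (inj₁ (inR x)) (inj₁ (y , k))) → refl
      ; (aux (inj₁ (inR x)) (inj₂ (k , (y , l)))) → refl
      ; (prin (inj₁ (inS x))) → refl ; (aux (inj₁ (inS x)) (y , l)) → refl
      ; (prin (inj₁ (outR y))) → refl ; (aux (inj₁ (outR y)) (x , k)) → refl
      ; (prin (inj₂ (y , tt))) → refl
      ; (aux (inj₂ (y , tt)) (inj₁ (x , l))) → refl
      ; (aux (inj₂ (y , tt)) (inj₂ (l , (x , k)))) → refl } }

  connect⇛routing : connect R o S i ⇛ Routing T
  connect⇛routing =
    ≅⇒⇛ connect≅facing
    ◅◅ plug-⇛ K-facing (facing⇛bipartite (proj₂ (Σ-Fin↔Fin b' (λ y → S (i , y))))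
                                         (proj₂ (Σ-Fin↔Fin a (λ x → R (x , o)))))
    ◅◅ ≅⇒⇛ bipartite≅bushesR
    ◅◅ plug-⇛ K-bushesR (disjoint-⇛ a BushLabelsR BushR FlatR (λ x → bush⇛flat qm (OtherR x) (R (x , o)) LeavesI))
    ◅◅ ≅⇒⇛ flatsR≅bushesS
    ◅◅ plug-⇛ K-bushesS (disjoint-⇛ b' BushLabelsS BushS FlatS (λ y → bush⇛flat bang (OtherS y) (S (i , y)) LeavesO))
    ◅◅ ≅⇒⇛ flatsS≅routing

mainTheorem9 : ∀ {a b a' b' : ℕ}
    (R : Multirel (Fin a) (Fin b)) (S : Multirel (Fin a') (Fin b'))
    (o : Fin b) (i : Fin a') →
    ∃ λ (T : Multirel (Fin a ⊎ (a' ∖ i)) ((b ∖ o) ⊎ Fin b')) →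
    connect R o S i ⇒* Routing T
mainTheorem9 R S o i = Connection.T R o S i , ⇛⇒⇒* (Connection.connect⇛routing R o S i)
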